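{- For all $X,Y\in\{0,1\}^\omega$ the following are equivalent: (1) $X$ is Kolmogorov $\mathrm{BP}$ random relative to $Y$; (2) $X$ is Martin-Löf $\mathrm{BP}$ random relative to $Y$; (3) $X$ is martingale $\mathrm{BP}$ random relative to $Y$.
   Context: A primitive recursive oracle machine is an oracle Turing machine $M^Z$ for which there is a primitive recursive $g$ such that, for all inputs $x$ and all reals $Z$, $M^Z(x)$ halts within $g(x)$ steps. A primitive recursive oracle function is a function $Z,x\mapsto M^Z(x)$ computed by such a machine. $[\sigma]$ is the set of reals extending the string $\sigma$, $[G]=\bigcup_{\sigma\in G}[\sigma]$, and $\mu$ is the uniform measure. Kolmogorov: $C^Y_M(\tau)$ is the least $|\sigma|$ with $M^Y(\sigma)=\tau$. $X$ is Kolmogorov $\mathrm{BP}$ random relative to $Y$ if there do not exist a primitive recursive oracle machine $M$ and a primitive recursive $f$ with $C^Y_M(X\upharpoonright f(c))\le f(c)-c$ for all $c$. Martin-Löf: a primitive recursive oracle test is given by a primitive recursive oracle function $g^Z$ and a primitive recursive $f$ such that, for all reals $Z$ and all $n$, $g^Z(n)$ codes a finite set $G^Z_n\subseteq\{0,1\}^{f(n)}$ with $\mu([G^Z_n])<2^{ -n}$. $X$ is Martin-Löf $\mathrm{BP}$ random relative to $Y$ if for every such test there is $n$ with $X\notin[G^Y_n]$. Martingale: a martingale is $d:\{0,1\}^*\to\mathbb Q\cap[0,\infty)$ with $d(\emptyset)=1$ and $d(\sigma)=(d(\sigma0)+d(\sigma1))/2$. A primitive recursive oracle martingale is a primitive recursive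 oracle function $d^Z$ which is a martingale for every real $Z$. It succeeds primitive recursively on $X$ (with oracle $Y$) if there is a primitive recursive $f$ with $d^Y(X\upharpoonright f(n))\ge 2^n$ for all $n$. $X$ is martingale $\mathrm{BP}$ random relative to $Y$ if no primitive recursive oracle martingale $d^Y$ succeeds primitive recursively on $X$. -}

module Defs where

open import Data.Nat using (ℕ; zero; suc; _+_; _*_; _^_; _≤_; _<_; _/_; _%_; _≡ᵇ_)
open import Data.Bool using (Bool; true; false; if_then_else_)
open import Data.Fin using (Fin)
open import Data.Vec using (Vec; []; _∷_; lookup)
open import Data.List using (List; []; _∷_; _++_; map; upTo; length)
open import Data.Product using (Σ; _×_; _,_)
open import Data.Integer using (+_)
open import Data.Rational using (ℚ; 1ℚ; ½) renaming (_/_ to _/ℚ_; _+_ to _+ℚ_; _*_ to _*ℚ_; _≤_ to _≤ℚ_)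
open import Relation.Binary.PropositionalEquality using (_≡_)
open import Relation.Nullary using (¬_)

Real : Set
Real = ℕ → Bool

Str : Set
Str = List Bool

_↾_ : Real → ℕ → Str
X ↾ n = map X (upTo n)

-- A term evaluates uniformly in every oracle Z.

data PR : ℕ → Set where
  zer  : ∀ {n} → PR n
  succ : PR 1
  proj : ∀ {n} → Fin n → PR n
  comp : ∀ {m n} → PR m → Vec (PR n) m → PR n
  rec  : ∀ {n} → PR n → PR (suc (suc n)) → PR (suc n)
  orc  : PR 1

mutual
  eval : ∀ {n} → PR n → Real → Vec ℕ n → ℕ
  eval zer Z xs = 0
  eval succ Z (x ∷ []) = suc x
  eval (proj i) Z xs = lookup xs i
  eval (comp f gs) Z xs = eval f Z (evalV gs Z xs)
  eval (rec g h) Z (k ∷ xs) = evalR g h Z k xs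
  eval orc Z (x ∷ []) = if Z x then 1 else 0

  evalV : ∀ {m n} → Vec (PR n) m → Real → Vec ℕ n → Vec ℕ m
  evalV [] Z xs = []
  evalV (g ∷ gs) Z xs = eval g Z xs ∷ evalV gs Z xs

  evalR : ∀ {n} → PR n → PR (suc (suc n)) → Real → ℕ → Vec ℕ n → ℕ
  evalR g h Z zero xs = eval g Z xs
  evalR g h Z (suc k) xs = eval h Z (k ∷ evalR g h Z k xs ∷ xs)

_⟦_⟧_ : PR 1 → Real → ℕ → ℕ
t ⟦ Z ⟧ x = eval t Z (x ∷ [])

PrimRec : (ℕ → ℕ) → Set
PrimRec f = Σ (PR 1) λ t → ∀ (Z : Real) (x : ℕ) → t ⟦ Z ⟧ x ≡ f x

-- bijective coding of binary strings by natural numbers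
code : Str → ℕ
code [] = 0
code (false ∷ s) = 1 + 2 * code s
code (true ∷ s) = 2 + 2 * code s

-- index of a string of length ℓ among the 2^ℓ strings of length ℓ
val : Str → ℕ
val [] = 0
val (b ∷ s) = (if b then 1 else 0) + 2 * val s

-- k-th binary digit of m (canonical coding of finite sets of naturals)
bit : ℕ → ℕ → Bool
bit zero m = m % 2 ≡ᵇ 1
bit (suc k) m = bit k (m / 2)

countBits : ℕ → ℕ → ℕ
countBits zero m = 0
countBits (suc N) m = countBits N m + (if bit N m then 1 else 0)

-- Kolmogorov BP randomness
-- M^Y(σ) = τ  is  M ⟦ Y ⟧ (code σ) ≡ code τ ;
-- C^Y_M(τ) ≤ k  iff  some σ with |σ| ≤ k has M^Y(σ) = τ.

C≤ : PR 1 → Real → Str → ℕ → Set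
C≤ M Y τ k = Σ Str λ σ → (length σ ≤ k) × (M ⟦ Y ⟧ code σ ≡ code τ)

KolmogorovBPRandom : Real → Real → Set
KolmogorovBPRandom X Y =
  ¬ (Σ (PR 1) λ M → Σ (ℕ → ℕ) λ f → PrimRec f ×
       (∀ c → Σ Str λ σ → (length σ + c ≤ f c) × (M ⟦ Y ⟧ code σ ≡ code (X ↾ f c))))

-- Martin-Löf BP randomness
-- g^Z(n) canonically codes the set G^Z_n of strings σ of length f(n)
-- with bit (val σ) of g^Z(n) equal to 1; g^Z(n) < 2^(2^f(n)) says that the
-- coded set is a subset of {0,1}^f(n).  μ([G]) = |G| / 2^f(n).

record PRTest : Set where
  field
    g : PR 1
    f : ℕ → ℕ
    f-pr : PrimRec f
    codes-subset : ∀ (Z : Real) n → g ⟦ Z ⟧ n < 2 ^ (2 ^ f n)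
    measure-small : ∀ (Z : Real) n → countBits (2 ^ f n) (g ⟦ Z ⟧ n) * 2 ^ n < 2 ^ f n

inCyl : PRTest → Real → Real → ℕ → Set
inCyl T Y X n = bit (val (X ↾ PRTest.f T n)) (PRTest.g T ⟦ Y ⟧ n) ≡ true

MartinLofBPRandom : Real → Real → Set
MartinLofBPRandom X Y = ∀ (T : PRTest) → ¬ (∀ n → inCyl T Y X n)

-- Martingale BP randomness
-- A primitive recursive oracle function with rational values is given by a
-- numerator and a denominator term: d^Z(σ) = num^Z(σ) / (den^Z(σ) + 1).

record PROracleMartingale : Set where
  field
    num : PR 1
    den : PR 1

  d : Real → Str → ℚ
  d Z σ = (+ (num ⟦ Z ⟧ code σ)) /ℚ suc (den ⟦ Z ⟧ code σ)

  field
    d-empty : ∀ (Z : Real) → d Z [] ≡ 1ℚ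
    d-fair : ∀ (Z : Real) (σ : Str) →
      d Z σ ≡ ½ *ℚ (d Z (σ ++ (false ∷ [])) +ℚ d Z (σ ++ (true ∷ [])))

SucceedsPR : PROracleMartingale → Real → Real → Set
SucceedsPR D Y X = Σ (ℕ → ℕ) λ f → PrimRec f ×
  (∀ n → (+ (2 ^ n)) /ℚ 1 ≤ℚ PROracleMartingale.d D Y (X ↾ f n))

MartingaleBPRandom : Real → Real → Set
MartingaleBPRandom X Y = ∀ (D : PROracleMartingale) → ¬ SucceedsPR D Y X

-- Each kind of witness that X is not random relative to Y is converted into the other kinds by
-- constructions that are primitive recursive uniformly in the oracle.
-- A compression M with |σ| + c ≤ f c gives the test whose n-th level is the set of strings of
-- length f (n + 1) that M outputs on inputs shorter than f (n + 1) ∸ n.  Conversely, a test gives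
-- the machine reading its input N + 1 = 2 ^ c * (2 i + 1) as "the member of rank i in level 2c + 1";
-- the measure bound of that level pays for the c extra input bits.
-- A martingale reaching 2 ^ n on X ↾ f n gives the test of strings of length f (n + 1) on which it
-- is at least 2 ^ (n + 1), small by Kolmogorov's equality Σ_{|σ| = ℓ} d σ = 2 ^ ℓ.  Conversely, a
-- test gives the martingale Σ_k 2 ^ -(k + 1) d_k, where d_k is 1 up to length k and then bets with
-- stake 2 ^ (2k + 1) on the conditional measure of level 3k + 1: the measure bound of that level
-- keeps d_k nonnegative, and d_k reaches 2 ^ (2k + 1) on the members of the level.
-- Rational values are carried as numerator/denominator pairs, which are closed under +, * and
-- bounded sums, so these martingales are primitive recursive.

module Submission where

open import Defs
open import Algebra.Bundles using (CommutativeMonoid)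
open import Data.Bool using (Bool; true; false; if_then_else_; T)
open import Data.Bool.Properties using (T-≡)
open import Data.Empty using (⊥-elim)
open import Data.Fin using (Fin)
open import Data.Fin.Patterns using (0F; 1F; 3F)
import Data.Integer as ℤ
import Data.Integer.Properties as ℤP
open import Data.List using ([]; _∷_; _++_; length; applyUpTo)
open import Data.List.Properties using (length-applyUpTo; map-upTo; length-++)
open import Data.Nat
open import Data.Nat.DivMod
open import Data.Nat.Divisibility using (_∣_; divides)
open import Data.Nat.Properties
open import Data.Nat.Tactic.RingSolver using (solve-∀)
open import Data.Product using (Σ; Σ-syntax; _×_; _,_; proj₁; proj₂; uncurry)
open import Data.Rational as ℚ using (ℚ; 0ℚ; 1ℚ; ½; toℚᵘ; fromℚᵘ)
import Data.Rational.Properties as ℚP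
import Data.Rational.Solver as ℚSolver
open import Data.Rational.Unnormalised using (mkℚᵘ; *≤*) renaming (_≃_ to _≃ᵘ_)
import Data.Rational.Unnormalised.Properties as ℚᵘP
open import Data.Vec using (Vec; []; _∷_; lookup; tabulate; head; tail)
open import Data.Vec.Properties using (tabulate∘lookup; tabulate-cong)
open import Function.Bundles using (_⇔_; mk⇔; Equivalence)
open import Relation.Binary using (tri<; tri≈; tri>)
open import Relation.Binary.PropositionalEquality
open import Relation.Nullary using (¬_; yes; no; contradiction)

-- Bounded sums

module MonoidSum {c ℓ} (M : CommutativeMonoid c ℓ) where

  open CommutativeMonoid M
    using (Carrier; _≈_; _∙_; ε; ∙-cong; assoc; identityˡ; identityʳ; commutativeSemigroup)
    renaming (refl to ≈-refl; sym to ≈-sym)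
  open import Algebra.Properties.CommutativeSemigroup commutativeSemigroup using (interchange)
  open import Relation.Binary.Reasoning.Setoid (CommutativeMonoid.setoid M)

  ∑< : ℕ → (ℕ → Carrier) → Carrier
  ∑< zero    f = ε
  ∑< (suc B) f = ∑< B f ∙ f B

  ∑<-cong : ∀ B {f g : ℕ → Carrier} → (∀ p → p < B → f p ≈ g p) → ∑< B f ≈ ∑< B g
  ∑<-cong zero    f≈g = ≈-refl
  ∑<-cong (suc B) f≈g = ∙-cong (∑<-cong B (λ p p<B → f≈g p (m<n⇒m<1+n p<B))) (f≈g B ≤-refl)

  ∑<-ε : ∀ B {f : ℕ → Carrier} → (∀ p → p < B → f p ≈ ε) → ∑< B f ≈ ε
  ∑<-ε zero    f≈ε = ≈-refl
  ∑<-ε (suc B) f≈ε = begin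
    ∑< B _ ∙ _ ≈⟨ ∙-cong (∑<-ε B (λ p p<B → f≈ε p (m<n⇒m<1+n p<B))) (f≈ε B ≤-refl) ⟩
    ε ∙ ε      ≈⟨ identityˡ ε ⟩
    ε          ∎

  ∑<-split : ∀ A B (f : ℕ → Carrier) → ∑< (A + B) f ≈ ∑< A f ∙ ∑< B (λ q → f (A + q))
  ∑<-split A zero f rewrite +-identityʳ A = ≈-sym (identityʳ _)
  ∑<-split A (suc B) f rewrite +-suc A B = begin
    ∑< (A + B) f ∙ f (A + B)                       ≈⟨ ∙-cong (∑<-split A B f) ≈-refl ⟩
    (∑< A f ∙ ∑< B (λ q → f (A + q))) ∙ f (A + B)  ≈⟨ assoc _ _ _ ⟩
    ∑< A f ∙ (∑< B (λ q → f (A + q)) ∙ f (A + B))  ∎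

  ∑<-distrib : ∀ B (f g : ℕ → Carrier) → ∑< B (λ p → f p ∙ g p) ≈ ∑< B f ∙ ∑< B g
  ∑<-distrib zero    f g = ≈-sym (identityˡ ε)
  ∑<-distrib (suc B) f g = begin
    ∑< B (λ p → f p ∙ g p) ∙ (f B ∙ g B)  ≈⟨ ∙-cong (∑<-distrib B f g) ≈-refl ⟩
    (∑< B f ∙ ∑< B g) ∙ (f B ∙ g B)      ≈⟨ interchange _ _ _ _ ⟩
    (∑< B f ∙ f B) ∙ (∑< B g ∙ g B)      ∎

  ∑<-swap : ∀ A B (f : ℕ → ℕ → Carrier) →
            ∑< A (λ p → ∑< B (f p)) ≈ ∑< B (λ q → ∑< A (λ p → f p q))
  ∑<-swap zero    B f = ≈-sym (∑<-ε B (λ _ _ → ≈-refl))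
  ∑<-swap (suc A) B f = begin
    ∑< A (λ p → ∑< B (f p)) ∙ ∑< B (f A)               ≈⟨ ∙-cong (∑<-swap A B f) ≈-refl ⟩
    ∑< B (λ q → ∑< A (λ p → f p q)) ∙ ∑< B (f A)       ≈⟨ ≈-sym (∑<-distrib B _ _) ⟩
    ∑< B (λ q → ∑< A (λ p → f p q) ∙ f A q)            ∎

open MonoidSum +-0-commutativeMonoid

∑<-shift : ∀ B (f : ℕ → ℕ) → ∑< (suc B) f ≡ f 0 + ∑< B (λ q → f (suc q))
∑<-shift B f = ∑<-split 1 B f

∑<-mono-≤ : ∀ B {f g : ℕ → ℕ} → (∀ p → p < B → f p ≤ g p) → ∑< B f ≤ ∑< B g
∑<-mono-≤ zero    f≤g = z≤n
∑<-mono-≤ (suc B) f≤g = +-mono-≤ (∑<-mono-≤ B (λ p p<B → f≤g p (m<n⇒m<1+n p<B))) (f≤g B ≤-refl)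

∑<-monoˡ-≤ : ∀ (f : ℕ → ℕ) {A B} → A ≤ B → ∑< A f ≤ ∑< B f
∑<-monoˡ-≤ f {A} {B} A≤B = begin
  ∑< A f                                  ≤⟨ m≤m+n _ _ ⟩
  ∑< A f + ∑< (B ∸ A) (λ q → f (A + q))   ≡⟨ ∑<-split A (B ∸ A) f ⟨
  ∑< (A + (B ∸ A)) f                      ≡⟨ cong (λ k → ∑< k f) (m+[n∸m]≡n A≤B) ⟩
  ∑< B f                                  ∎
  where open ≤-Reasoning

term≤∑< : ∀ (f : ℕ → ℕ) {p B} → p < B → f p ≤ ∑< B f
term≤∑< f {p} p<B = ≤-trans (m≤n+m (f p) (∑< p f)) (∑<-monoˡ-≤ f p<B)

∑<-*ˡ : ∀ B c (f : ℕ → ℕ) → ∑< B (λ p → c * f p) ≡ c * ∑< B f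
∑<-*ˡ zero    c f = sym (*-zeroʳ c)
∑<-*ˡ (suc B) c f = trans (cong (_+ c * f B) (∑<-*ˡ B c f)) (sym (*-distribˡ-+ c _ _))

∑<-const : ∀ B c → ∑< B (λ _ → c) ≡ B * c
∑<-const zero    c = refl
∑<-const (suc B) c = trans (cong (_+ c) (∑<-const B c)) (+-comm (B * c) c)

∑<-single : ∀ B (f : ℕ → ℕ) {q} → q < B → (∀ p → p < B → p ≢ q → f p ≡ 0) → ∑< B f ≡ f q
∑<-single (suc B) f {q} (s≤s q≤B) others with q ≟ B
... | yes refl = cong (_+ f q) (∑<-ε q (λ p p<q → others p (m<n⇒m<1+n p<q) (<⇒≢ p<q)))
... | no  q≢B  = trans (cong₂ _+_ (∑<-single B f (≤∧≢⇒< q≤B q≢B) (λ p p<B → others p (m<n⇒m<1+n p<B)))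
                                  (others B ≤-refl (≢-sym q≢B)))
                       (+-identityʳ (f q))

∑<-prefix : ∀ {B c} (f : ℕ → ℕ) → c ≤ B →
            (∀ j → j < c → f j ≡ 1) → (∀ j → c ≤ j → f j ≡ 0) → ∑< B f ≡ c
∑<-prefix {B} {c} f c≤B below above = begin
  ∑< B f
    ≡⟨ cong (λ k → ∑< k f) (m+[n∸m]≡n c≤B) ⟨
  ∑< (c + (B ∸ c)) f
    ≡⟨ ∑<-split c (B ∸ c) f ⟩
  ∑< c f + ∑< (B ∸ c) (λ q → f (c + q))
    ≡⟨ cong₂ _+_ (∑<-cong c below) (∑<-ε (B ∸ c) (λ q _ → above (c + q) (m≤m+n c q))) ⟩
  ∑< c (λ _ → 1) + 0
    ≡⟨ trans (+-identityʳ _) (trans (∑<-const c 1) (*-identityʳ c)) ⟩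
  c
    ∎
  where open ≡-Reasoning

-- Binary expansions and codes of strings

indicator : Bool → ℕ
indicator b = if b then 1 else 0

indicator≤1 : ∀ b → indicator b ≤ 1
indicator≤1 true  = ≤-refl
indicator≤1 false = z≤n

indicator-T : ∀ {b} → T b → indicator b ≡ 1
indicator-T {true} _ = refl

indicator-¬T : ∀ {b} → ¬ T b → indicator b ≡ 0
indicator-¬T {false} _  = refl
indicator-¬T {true}  ¬t = ⊥-elim (¬t _)

indicator-≡ᵇ-≢ : ∀ {a b} → a ≢ b → indicator (a ≡ᵇ b) ≡ 0
indicator-≡ᵇ-≢ {a} {b} a≢b = indicator-¬T (λ t → a≢b (≡ᵇ⇒≡ a b t))

infixl 7 _/2^_ _%2^_

-- Instance search cannot find NonZero (2 ^ k), so it is supplied here once.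
_/2^_ : ℕ → ℕ → ℕ
m /2^ k = (m / 2 ^ k) {{m^n≢0 2 k}}

_%2^_ : ℕ → ℕ → ℕ
m %2^ k = (m % 2 ^ k) {{m^n≢0 2 k}}

[2+m]%2≡m%2 : ∀ m → suc (suc m) % 2 ≡ m % 2
[2+m]%2≡m%2 m = trans (cong (_% 2) (+-comm 2 m)) ([m+n]%n≡m%n m 2)

[2+m]/2≡1+m/2 : ∀ m → suc (suc m) / 2 ≡ suc (m / 2)
[2+m]/2≡1+m/2 m = m/n≡1+[m∸n]/n {suc (suc m)} {2} (s≤s (s≤s z≤n))

[1+m]%2≡1∸m%2 : ∀ m → suc m % 2 ≡ 1 ∸ m % 2
[1+m]%2≡1∸m%2 zero          = refl
[1+m]%2≡1∸m%2 (suc zero)    = refl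
[1+m]%2≡1∸m%2 (suc (suc m)) =
  trans ([2+m]%2≡m%2 (suc m)) (trans ([1+m]%2≡1∸m%2 m) (cong (1 ∸_) (sym ([2+m]%2≡m%2 m))))

[1+m]/2≡m/2+m%2 : ∀ m → suc m / 2 ≡ m / 2 + m % 2
[1+m]/2≡m/2+m%2 zero          = refl
[1+m]/2≡m/2+m%2 (suc zero)    = refl
[1+m]/2≡m/2+m%2 (suc (suc m)) = trans ([2+m]/2≡1+m/2 (suc m))
  (trans (cong suc ([1+m]/2≡m/2+m%2 m)) (cong₂ _+_ (sym ([2+m]/2≡1+m/2 m)) (sym ([2+m]%2≡m%2 m))))

m/2^[1+k]≡m/2^k/2 : ∀ m k → m /2^ suc k ≡ m /2^ k / 2
m/2^[1+k]≡m/2^k/2 m k =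
  sym (trans (m/n/o≡m/[n*o] m (2 ^ k) 2 {{m^n≢0 2 k}} {{_}} {{m*n≢0 (2 ^ k) 2 {{m^n≢0 2 k}}}})
             (/-congʳ {{m*n≢0 (2 ^ k) 2 {{m^n≢0 2 k}}}} {{m^n≢0 2 (suc k)}} (*-comm (2 ^ k) 2)))

indicator-≡ᵇ1 : ∀ r → r ≤ 1 → indicator (r ≡ᵇ 1) ≡ r
indicator-≡ᵇ1 zero       _ = refl
indicator-≡ᵇ1 (suc zero) _ = refl
indicator-≡ᵇ1 (2+ r) (s≤s ())

indicator-bit : ∀ k m → indicator (bit k m) ≡ m /2^ k % 2
indicator-bit zero    m = trans (indicator-≡ᵇ1 (m % 2) (≤-pred (m%n<n m 2))) (cong (_% 2) (sym (n/1≡n m)))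
indicator-bit (suc k) m = trans (indicator-bit k (m / 2))
  (cong (_% 2) (m/n/o≡m/[n*o] m 2 (2 ^ k) {{_}} {{m^n≢0 2 k}} {{m^n≢0 2 (suc k)}}))

[2y]%2≡0 : ∀ y → 2 * y % 2 ≡ 0
[2y]%2≡0 y = trans (cong (_% 2) (*-comm 2 y)) (m*n%n≡0 y 2)

[1+2y]%2≡1 : ∀ y → (1 + 2 * y) % 2 ≡ 1
[1+2y]%2≡1 y = trans (cong (λ t → (1 + t) % 2) (*-comm 2 y)) ([m+kn]%n≡m%n 1 y 2)

[2y]/2≡y : ∀ y → 2 * y / 2 ≡ y
[2y]/2≡y y = trans (/-congˡ (*-comm 2 y)) (m*n/n≡m y 2)

[1+2y]/2≡y : ∀ y → (1 + 2 * y) / 2 ≡ y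
[1+2y]/2≡y y = trans (+-distrib-/-∣ʳ 1 (divides y (*-comm 2 y))) ([2y]/2≡y y)

bit0-2* : ∀ y → bit 0 (2 * y) ≡ false
bit0-2* y rewrite [2y]%2≡0 y = refl

bit0-1+2* : ∀ y → bit 0 (1 + 2 * y) ≡ true
bit0-1+2* y rewrite [1+2y]%2≡1 y = refl

bit-suc-2* : ∀ k y → bit (suc k) (2 * y) ≡ bit k y
bit-suc-2* k y = cong (bit k) ([2y]/2≡y y)

bit-suc-1+2* : ∀ k y → bit (suc k) (1 + 2 * y) ≡ bit k y
bit-suc-1+2* k y = cong (bit k) ([1+2y]/2≡y y)

bit0-val : ∀ b s → bit 0 (val (b ∷ s)) ≡ b
bit0-val true  s = bit0-1+2* (val s)
bit0-val false s = bit0-2* (val s)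

bit-suc-val : ∀ k b s → bit (suc k) (val (b ∷ s)) ≡ bit k (val s)
bit-suc-val k true  s = bit-suc-1+2* k (val s)
bit-suc-val k false s = bit-suc-2* k (val s)

bit-val-applyUpTo : ∀ (h : ℕ → Bool) {i K} → i < K → bit i (val (applyUpTo h K)) ≡ h i
bit-val-applyUpTo h {zero}  {suc K} _         = bit0-val (h 0) (applyUpTo (λ q → h (suc q)) K)
bit-val-applyUpTo h {suc i} {suc K} (s≤s i<K) =
  trans (bit-suc-val i (h 0) (applyUpTo (λ q → h (suc q)) K)) (bit-val-applyUpTo (λ q → h (suc q)) i<K)

val<2^length : ∀ s → val s < 2 ^ length s
val<2^length []      = s≤s z≤n
val<2^length (b ∷ s) = begin-strict
  indicator b + 2 * val s
    ≤⟨ +-monoˡ-≤ (2 * val s) (indicator≤1 b) ⟩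
  1 + 2 * val s
    <⟨ subst (_≤ 2 * 2 ^ length s) (*-suc 2 (val s)) (*-monoʳ-≤ 2 (val<2^length s)) ⟩
  2 * 2 ^ length s
    ∎
  where open ≤-Reasoning

val-applyUpTo : ∀ (h : ℕ → Bool) K → val (applyUpTo h K) ≡ ∑< K (λ q → 2 ^ q * indicator (h q))
val-applyUpTo h zero    = refl
val-applyUpTo h (suc K) = begin
  indicator (h 0) + 2 * val (applyUpTo (λ q → h (suc q)) K)
    ≡⟨ cong (λ t → indicator (h 0) + 2 * t) (val-applyUpTo (λ q → h (suc q)) K) ⟩
  indicator (h 0) + 2 * ∑< K (λ q → 2 ^ q * indicator (h (suc q)))
    ≡⟨ cong (indicator (h 0) +_) (trans (sym (∑<-*ˡ K 2 _)) (∑<-cong K (λ q _ → sym (*-assoc 2 (2 ^ q) _)))) ⟩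
  indicator (h 0) + ∑< K (λ q → 2 ^ suc q * indicator (h (suc q)))
    ≡⟨ cong (_+ ∑< K (λ q → 2 ^ suc q * indicator (h (suc q)))) (sym (+-identityʳ (indicator (h 0)))) ⟩
  1 * indicator (h 0) + ∑< K (λ q → 2 ^ suc q * indicator (h (suc q)))
    ≡⟨ ∑<-shift K _ ⟨
  ∑< (suc K) (λ q → 2 ^ q * indicator (h q))
    ∎
  where open ≡-Reasoning

countBits≡∑< : ∀ N m → countBits N m ≡ ∑< N (λ k → indicator (bit k m))
countBits≡∑< zero    m = refl
countBits≡∑< (suc N) m = cong (_+ indicator (bit N m)) (countBits≡∑< N m)

countBits-val-applyUpTo : ∀ (h : ℕ → Bool) K →
                          countBits K (val (applyUpTo h K)) ≡ ∑< K (λ q → indicator (h q))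
countBits-val-applyUpTo h K =
  trans (countBits≡∑< K _) (∑<-cong K (λ q q<K → cong indicator (bit-val-applyUpTo h q<K)))

2^suc≡2^+2^ : ∀ ℓ → 2 ^ suc ℓ ≡ 2 ^ ℓ + 2 ^ ℓ
2^suc≡2^+2^ ℓ = cong (2 ^ ℓ +_) (+-identityʳ (2 ^ ℓ))

n<2^n : ∀ n → n < 2 ^ n
n<2^n zero    = s≤s z≤n
n<2^n (suc n) = +-mono-≤ (m^n>0 2 n) (≤-trans (n<2^n n) (m≤m+n (2 ^ n) 0))

2^-cancel-≤ : ∀ {a b} → 2 ^ a ≤ 2 ^ b → a ≤ b
2^-cancel-≤ {a} {b} 2^a≤2^b with a ≤? b
... | yes a≤b = a≤b
... | no  a≰b = contradiction 2^a≤2^b (<⇒≱ (^-monoʳ-< 2 (s≤s (s≤s z≤n)) (≰⇒> a≰b)))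

2^-cancel-< : ∀ {a b} → 2 ^ a < 2 ^ b → a < b
2^-cancel-< {a} {b} 2^a<2^b with a <? b
... | yes a<b = a<b
... | no  a≮b = contradiction 2^a<2^b (≤⇒≯ (^-monoʳ-≤ 2 (≮⇒≥ a≮b)))

suc-pred[2^ℓ] : ∀ ℓ → suc (pred (2 ^ ℓ)) ≡ 2 ^ ℓ
suc-pred[2^ℓ] ℓ = suc-pred (2 ^ ℓ) {{m^n≢0 2 ℓ}}

m*2≤n⇒m<n : ∀ {m n} → m * 2 ≤ n → 0 < n → m < n
m*2≤n⇒m<n {zero}  _     0<n = 0<n
m*2≤n⇒m<n {suc m} m*2≤n _   = <-≤-trans (m<m*n (suc m) 2 (s≤s (s≤s z≤n))) m*2≤n

*2^<2^ : ∀ {x} F n → x ≤ pred (2 ^ (F ∸ n)) → x * 2 ^ n < 2 ^ F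
*2^<2^ {x} F n x≤ with n ≤? F
... | yes n≤F = begin-strict
  x * 2 ^ n                 ≤⟨ *-monoˡ-≤ (2 ^ n) x≤ ⟩
  pred (2 ^ (F ∸ n)) * 2 ^ n <⟨ *-monoˡ-< (2 ^ n) {{m^n≢0 2 n}} (≤-reflexive (suc-pred[2^ℓ] (F ∸ n))) ⟩
  2 ^ (F ∸ n) * 2 ^ n       ≡⟨ ^-distribˡ-+-* 2 (F ∸ n) n ⟨
  2 ^ (F ∸ n + n)           ≡⟨ cong (2 ^_) (m∸n+n≡m n≤F) ⟩
  2 ^ F                     ∎
  where open ≤-Reasoning
... | no  n≰F = subst (λ y → y * 2 ^ n < 2 ^ F) (sym (n≤0⇒n≡0 (subst (x ≤_) pred[2^[F∸n]]≡0 x≤))) (m^n>0 2 F)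
  where
  pred[2^[F∸n]]≡0 : pred (2 ^ (F ∸ n)) ≡ 0
  pred[2^[F∸n]]≡0 rewrite m≤n⇒m∸n≡0 (<⇒≤ (≰⇒> n≰F)) = refl

*2^<2^⇒≤2^∸ : ∀ {a} k F → a * 2 ^ k < 2 ^ F → a ≤ 2 ^ (F ∸ k)
*2^<2^⇒≤2^∸ {a} k F a*2^k<2^F with k ≤? F
... | yes k≤F = <⇒≤ (*-cancelʳ-< (2 ^ k) a (2 ^ (F ∸ k)) (begin-strict
  a * 2 ^ k            <⟨ a*2^k<2^F ⟩
  2 ^ F                ≡⟨ cong (2 ^_) (m∸n+n≡m k≤F) ⟨
  2 ^ (F ∸ k + k)      ≡⟨ ^-distribˡ-+-* 2 (F ∸ k) k ⟩
  2 ^ (F ∸ k) * 2 ^ k  ∎))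
  where open ≤-Reasoning
... | no  k≰F = subst (_≤ 2 ^ (F ∸ k)) (sym (n<1⇒n≡0 a<1)) z≤n
  where
  a<1 : a < 1
  a<1 = *-cancelʳ-< (2 ^ k) a 1 (<-trans a*2^k<2^F (subst (2 ^ F <_) (sym (*-identityˡ (2 ^ k)))
          (^-monoʳ-< 2 (s≤s (s≤s z≤n)) (≰⇒> k≰F))))

2^∣2^ : ∀ {j ℓ} → j ≤ ℓ → 2 ^ j ∣ 2 ^ ℓ
2^∣2^ {j} {ℓ} j≤ℓ =
  divides (2 ^ (ℓ ∸ j)) (trans (cong (2 ^_) (sym (m∸n+n≡m j≤ℓ))) (^-distribˡ-+-* 2 (ℓ ∸ j) j))

%2^-+2^ : ∀ {j ℓ} v → j ≤ ℓ → (2 ^ ℓ + v) %2^ j ≡ v %2^ j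
%2^-+2^ {j} v j≤ℓ = %-remove-+ˡ v {{m^n≢0 2 j}} (2^∣2^ j≤ℓ)

≡ᵇ-+ˡ : ∀ K a b → (K + a ≡ᵇ K + b) ≡ (a ≡ᵇ b)
≡ᵇ-+ˡ zero    a b = refl
≡ᵇ-+ˡ (suc K) a b = ≡ᵇ-+ˡ K a b

indicator-%2^-split : ∀ ℓ {r u} → r < 2 ^ suc ℓ → u < 2 ^ ℓ →
                      indicator (r ≡ᵇ u) + indicator (r ≡ᵇ 2 ^ ℓ + u) ≡ indicator (r %2^ ℓ ≡ᵇ u)
indicator-%2^-split ℓ {r} {u} r<2^[1+ℓ] u<2^ℓ with r <? 2 ^ ℓ
... | yes r<2^ℓ = begin
  indicator (r ≡ᵇ u) + indicator (r ≡ᵇ 2 ^ ℓ + u)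
    ≡⟨ cong (indicator (r ≡ᵇ u) +_) (indicator-≡ᵇ-≢ (<⇒≢ (<-≤-trans r<2^ℓ (m≤m+n _ u)))) ⟩
  indicator (r ≡ᵇ u) + 0
    ≡⟨ +-identityʳ _ ⟩
  indicator (r ≡ᵇ u)
    ≡⟨ cong (λ x → indicator (x ≡ᵇ u)) (m<n⇒m%n≡m {{m^n≢0 2 ℓ}} r<2^ℓ) ⟨
  indicator (r %2^ ℓ ≡ᵇ u)
    ∎
  where open ≡-Reasoning
... | no  r≮2^ℓ = begin
  indicator (r ≡ᵇ u) + indicator (r ≡ᵇ 2 ^ ℓ + u)
    ≡⟨ cong (_+ indicator (r ≡ᵇ 2 ^ ℓ + u)) (indicator-≡ᵇ-≢ (≢-sym (<⇒≢ (<-≤-trans u<2^ℓ 2^ℓ≤r)))) ⟩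
  indicator (r ≡ᵇ 2 ^ ℓ + u)
    ≡⟨ cong (λ x → indicator (x ≡ᵇ 2 ^ ℓ + u)) (m+[n∸m]≡n 2^ℓ≤r) ⟨
  indicator (2 ^ ℓ + r′ ≡ᵇ 2 ^ ℓ + u)
    ≡⟨ cong indicator (≡ᵇ-+ˡ (2 ^ ℓ) r′ u) ⟩
  indicator (r′ ≡ᵇ u)
    ≡⟨ cong (λ x → indicator (x ≡ᵇ u)) r′≡r%2^ℓ ⟩
  indicator (r %2^ ℓ ≡ᵇ u)
    ∎
  where
  open ≡-Reasoning
  2^ℓ≤r : 2 ^ ℓ ≤ r
  2^ℓ≤r = ≮⇒≥ r≮2^ℓ
  r′ : ℕ
  r′ = r ∸ 2 ^ ℓ
  r′<2^ℓ : r′ < 2 ^ ℓ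
  r′<2^ℓ = subst (r′ <_) (trans (cong (_∸ 2 ^ ℓ) (2^suc≡2^+2^ ℓ)) (m+n∸m≡n (2 ^ ℓ) (2 ^ ℓ)))
                 (∸-monoˡ-< r<2^[1+ℓ] 2^ℓ≤r)
  r′≡r%2^ℓ : r′ ≡ r %2^ ℓ
  r′≡r%2^ℓ = trans (sym (m<n⇒m%n≡m {{m^n≢0 2 ℓ}} r′<2^ℓ))
                   (m≤n⇒[n∸m]%m≡n%m {{m^n≢0 2 ℓ}} 2^ℓ≤r)

codeOf : ℕ → ℕ → ℕ
codeOf ℓ v = pred (2 ^ ℓ) + v

suc-codeOf : ∀ ℓ v → suc (codeOf ℓ v) ≡ 2 ^ ℓ + v
suc-codeOf ℓ v = cong (_+ v) (suc-pred[2^ℓ] ℓ)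

double-suc : ∀ {c} P v → suc c ≡ P + v → suc (suc (2 * c)) ≡ 2 * P + 2 * v
double-suc {c} P v e = trans (sym (*-suc 2 c)) (trans (cong (2 *_) e) (*-distribˡ-+ 2 P v))

suc-code : ∀ s → suc (code s) ≡ 2 ^ length s + val s
suc-code []          = refl
suc-code (false ∷ s) = double-suc (2 ^ length s) (val s) (suc-code s)
suc-code (true ∷ s)  = trans (cong suc (double-suc (2 ^ length s) (val s) (suc-code s)))
                             (sym (+-suc (2 * 2 ^ length s) (2 * val s)))

code≡codeOf : ∀ s → code s ≡ codeOf (length s) (val s)
code≡codeOf s = suc-injective (trans (suc-code s) (sym (suc-codeOf (length s) (val s))))

2^length≤suc-code : ∀ s → 2 ^ length s ≤ suc (code s)
2^length≤suc-code s = subst (2 ^ length s ≤_) (sym (suc-code s)) (m≤m+n _ _)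

length-↾ : ∀ X F → length (X ↾ F) ≡ F
length-↾ X F = trans (cong length (map-upTo X F)) (length-applyUpTo X F)

val-↾<2^ : ∀ X F → val (X ↾ F) < 2 ^ F
val-↾<2^ X F = subst (λ ℓ → val (X ↾ F) < 2 ^ ℓ) (length-↾ X F) (val<2^length (X ↾ F))

code-↾ : ∀ X F → code (X ↾ F) ≡ codeOf F (val (X ↾ F))
code-↾ X F = trans (code≡codeOf (X ↾ F)) (cong (λ ℓ → codeOf ℓ (val (X ↾ F))) (length-↾ X F))

length-∷ʳ : ∀ (s : Str) b → length (s ++ b ∷ []) ≡ suc (length s)
length-∷ʳ s b = trans (length-++ s {b ∷ []}) (+-comm (length s) 1)

val-∷ʳ : ∀ s b → val (s ++ b ∷ []) ≡ val s + 2 ^ length s * indicator b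
val-∷ʳ []      b = trans (+-identityʳ (indicator b)) (sym (+-identityʳ _))
val-∷ʳ (c ∷ s) b = trans (cong (λ t → indicator c + 2 * t) (val-∷ʳ s b))
                         (ring (indicator c) (val s) (2 ^ length s) (indicator b))
  where
  ring : ∀ a v P x → a + 2 * (v + P * x) ≡ a + 2 * v + 2 * P * x
  ring = solve-∀

val-∷ʳ-if : ∀ s b → val (s ++ b ∷ []) ≡ (if b then 2 ^ length s + val s else val s)
val-∷ʳ-if s true  =
  trans (val-∷ʳ s true) (trans (cong (val s +_) (*-identityʳ (2 ^ length s))) (+-comm (val s) _))
val-∷ʳ-if s false =
  trans (val-∷ʳ s false) (trans (cong (val s +_) (*-zeroʳ (2 ^ length s))) (+-identityʳ (val s)))

-- Successor in the bijective base-2 numeration read by code.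
inc : Str → Str
inc []          = false ∷ []
inc (false ∷ s) = true ∷ s
inc (true ∷ s)  = false ∷ inc s

code-inc : ∀ s → code (inc s) ≡ suc (code s)
code-inc []          = refl
code-inc (false ∷ s) = refl
code-inc (true ∷ s)  = trans (cong (λ t → 1 + 2 * t) (code-inc s)) (cong suc (*-suc 2 (code s)))

decode : ℕ → Str
decode zero    = []
decode (suc N) = inc (decode N)

code-decode : ∀ N → code (decode N) ≡ N
code-decode zero    = refl
code-decode (suc N) = trans (code-inc (decode N)) (cong suc (code-decode N))

lengthOfCode : ℕ → ℕ
lengthOfCode N = ∑< N (λ j → indicator (2 ^ suc j ≤ᵇ suc N))

valueOfCode : ℕ → ℕ
valueOfCode N = suc N ∸ 2 ^ lengthOfCode N

lengthOfCode-codeOf : ∀ ℓ {v} → v < 2 ^ ℓ → lengthOfCode (codeOf ℓ v) ≡ ℓ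
lengthOfCode-codeOf ℓ {v} v<2^ℓ = ∑<-prefix _ ℓ≤N below above
  where
  open ≤-Reasoning
  N : ℕ
  N = codeOf ℓ v
  ℓ≤N : ℓ ≤ N
  ℓ≤N = ≤-trans (≤-pred (subst (suc ℓ ≤_) (sym (suc-pred[2^ℓ] ℓ)) (n<2^n ℓ))) (m≤m+n _ v)
  below : ∀ j → j < ℓ → indicator (2 ^ suc j ≤ᵇ suc N) ≡ 1
  below j j<ℓ = indicator-T (≤⇒≤ᵇ (begin
    2 ^ suc j  ≤⟨ ^-monoʳ-≤ 2 j<ℓ ⟩
    2 ^ ℓ      ≤⟨ m≤m+n _ v ⟩
    2 ^ ℓ + v  ≡⟨ suc-codeOf ℓ v ⟨
    suc N      ∎))
  above : ∀ j → ℓ ≤ j → indicator (2 ^ suc j ≤ᵇ suc N) ≡ 0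
  above j ℓ≤j = indicator-¬T (λ t → <⇒≱ N<2^[1+j] (≤ᵇ⇒≤ _ _ t))
    where
    N<2^[1+j] : suc N < 2 ^ suc j
    N<2^[1+j] = begin-strict
      suc N          ≡⟨ suc-codeOf ℓ v ⟩
      2 ^ ℓ + v      <⟨ +-monoʳ-< (2 ^ ℓ) v<2^ℓ ⟩
      2 ^ ℓ + 2 ^ ℓ  ≡⟨ cong (2 ^ ℓ +_) (+-identityʳ (2 ^ ℓ)) ⟨
      2 ^ suc ℓ      ≤⟨ ^-monoʳ-≤ 2 (s≤s ℓ≤j) ⟩
      2 ^ suc j      ∎

valueOfCode-codeOf : ∀ ℓ {v} → v < 2 ^ ℓ → valueOfCode (codeOf ℓ v) ≡ v
valueOfCode-codeOf ℓ {v} v<2^ℓ = begin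
  suc (codeOf ℓ v) ∸ 2 ^ lengthOfCode (codeOf ℓ v)
    ≡⟨ cong₂ (λ a b → a ∸ 2 ^ b) (suc-codeOf ℓ v) (lengthOfCode-codeOf ℓ v<2^ℓ) ⟩
  2 ^ ℓ + v ∸ 2 ^ ℓ
    ≡⟨ m+n∸m≡n (2 ^ ℓ) v ⟩
  v
    ∎
  where open ≡-Reasoning

lengthOfCode-code : ∀ s → lengthOfCode (code s) ≡ length s
lengthOfCode-code s =
  trans (cong lengthOfCode (code≡codeOf s)) (lengthOfCode-codeOf (length s) (val<2^length s))

valueOfCode-code : ∀ s → valueOfCode (code s) ≡ val s
valueOfCode-code s =
  trans (cong valueOfCode (code≡codeOf s)) (valueOfCode-codeOf (length s) (val<2^length s))

-- Primitive recursive oracle functions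

PRFun : (n : ℕ) → (Real → Vec ℕ n → ℕ) → Set
PRFun n F = Σ[ t ∈ PR n ] ∀ Z ρ → eval t Z ρ ≡ F Z ρ

natrec : (ℕ → ℕ → ℕ) → ℕ → ℕ → ℕ
natrec s b zero    = b
natrec s b (suc k) = s k (natrec s b k)

natrec-unique : ∀ {s b} (f : ℕ → ℕ) → f 0 ≡ b → (∀ k → f (suc k) ≡ s k (f k)) →
                ∀ k → natrec s b k ≡ f k
natrec-unique f f0 fsuc zero    = sym f0
natrec-unique {s} f f0 fsuc (suc k) = trans (cong (s k) (natrec-unique f f0 fsuc k)) (sym (fsuc k))

natrec-cong : ∀ {s s′ : ℕ → ℕ → ℕ} {b} → (∀ k acc → s k acc ≡ s′ k acc) →
              ∀ k → natrec s b k ≡ natrec s′ b k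
natrec-cong s≡s′ zero    = refl
natrec-cong {s} s≡s′ (suc k) = trans (cong (s k) (natrec-cong s≡s′ k)) (s≡s′ k _)

evalR-natrec : ∀ {n} (g : PR n) (h : PR (suc (suc n))) Z k ρ →
               evalR g h Z k ρ ≡ natrec (λ k acc → eval h Z (k ∷ acc ∷ ρ)) (eval g Z ρ) k
evalR-natrec g h Z zero    ρ = refl
evalR-natrec g h Z (suc k) ρ = cong (λ acc → eval h Z (k ∷ acc ∷ ρ)) (evalR-natrec g h Z k ρ)

pr-resp : ∀ {n F G} → PRFun n F → (∀ Z ρ → F Z ρ ≡ G Z ρ) → PRFun n G
pr-resp (t , t≡F) F≡G = t , λ Z ρ → trans (t≡F Z ρ) (F≡G Z ρ)

pr-var : ∀ {n} (i : Fin n) → PRFun n (λ Z ρ → lookup ρ i)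
pr-var i = proj i , λ Z ρ → refl

pr-zero : ∀ {n} → PRFun n (λ Z ρ → 0)
pr-zero = zer , λ Z ρ → refl

evalV-tabulate : ∀ {n m} (ts : Fin m → PR n) Z ρ →
                 evalV (tabulate ts) Z ρ ≡ tabulate (λ i → eval (ts i) Z ρ)
evalV-tabulate {m = zero}  ts Z ρ = refl
evalV-tabulate {m = suc m} ts Z ρ = cong (eval (ts 0F) Z ρ ∷_) (evalV-tabulate (λ i → ts (Fin.suc i)) Z ρ)

pr-compose : ∀ {n m F} {G : Fin m → Real → Vec ℕ n → ℕ} → PRFun m F → (∀ i → PRFun n (G i)) →
             PRFun n (λ Z ρ → F Z (tabulate (λ i → G i Z ρ)))
pr-compose (t , t≡F) gs =
  comp t (tabulate (λ i → proj₁ (gs i))) , λ Z ρ →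
    trans (cong (eval t Z) (trans (evalV-tabulate (λ i → proj₁ (gs i)) Z ρ)
                                  (tabulate-cong (λ i → proj₂ (gs i) Z ρ))))
          (t≡F Z _)

pr-apply₁ : ∀ {n A} {f : ℕ → ℕ} → PRFun 1 (λ Z ρ → f (head ρ)) → PRFun n A → PRFun n (λ Z ρ → f (A Z ρ))
pr-apply₁ {A = A} pf a = pr-compose {G = λ _ → A} pf (λ _ → a)

pr-apply₂ : ∀ {n A B} {f : ℕ → ℕ → ℕ} → PRFun 2 (λ Z ρ → f (head ρ) (head (tail ρ))) →
            PRFun n A → PRFun n B → PRFun n (λ Z ρ → f (A Z ρ) (B Z ρ))
pr-apply₂ {n} {A} {B} pf a b = pr-compose {G = G} pf args
  where
  G : Fin 2 → Real → Vec ℕ n → ℕ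
  G 0F = A
  G 1F = B
  args : ∀ i → PRFun n (G i)
  args 0F = a
  args 1F = b

pr-suc : ∀ {n A} → PRFun n A → PRFun n (λ Z ρ → suc (A Z ρ))
pr-suc = pr-apply₁ (succ , λ { Z (x ∷ []) → refl })

pr-const : ∀ {n} c → PRFun n (λ Z ρ → c)
pr-const zero    = pr-zero
pr-const (suc c) = pr-suc (pr-const c)

pr-term : ∀ {n A} (t : PR 1) → PRFun n A → PRFun n (λ Z ρ → t ⟦ Z ⟧ A Z ρ)
pr-term t (a , a≡A) = comp t (a ∷ []) , λ Z ρ → cong (λ x → t ⟦ Z ⟧ x) (a≡A Z ρ)

pr-primRec : ∀ {n A} {f : ℕ → ℕ} → PrimRec f → PRFun n A → PRFun n (λ Z ρ → f (A Z ρ))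
pr-primRec (t , t≡f) a = pr-resp (pr-term t a) (λ Z ρ → t≡f Z _)

pr-weaken : ∀ {n F} → PRFun n F → PRFun (suc n) (λ Z ρ → F Z (tail ρ))
pr-weaken {F = F} f = pr-resp (pr-compose {G = λ i Z ρ → lookup ρ (Fin.suc i)} f (λ i → pr-var (Fin.suc i)))
  λ { Z (x ∷ ρ) → cong (F Z) (tabulate∘lookup ρ) }



pr-natrec : ∀ {n B G H} → PRFun n B → PRFun n G → PRFun (suc (suc n)) H →
            PRFun n (λ Z ρ → natrec (λ k acc → H Z (k ∷ acc ∷ ρ)) (G Z ρ) (B Z ρ))
pr-natrec {n} {B} {G} {H} b (g , g≡G) (h , h≡H) =
  pr-resp (pr-compose {G = args} ((rec g h) , λ Z ρ → refl) argsPR)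
    λ Z ρ → begin
      evalR g h Z (B Z ρ) (tail (tabulate (λ i → args i Z ρ)))
        ≡⟨ cong (evalR g h Z (B Z ρ)) (tabulate∘lookup ρ) ⟩
      evalR g h Z (B Z ρ) ρ
        ≡⟨ evalR-natrec g h Z (B Z ρ) ρ ⟩
      natrec (λ k acc → eval h Z (k ∷ acc ∷ ρ)) (eval g Z ρ) (B Z ρ)
        ≡⟨ cong (λ b → natrec _ b (B Z ρ)) (g≡G Z ρ) ⟩
      natrec (λ k acc → eval h Z (k ∷ acc ∷ ρ)) (G Z ρ) (B Z ρ)
        ≡⟨ natrec-cong (λ k acc → h≡H Z (k ∷ acc ∷ ρ)) (B Z ρ) ⟩
      natrec (λ k acc → H Z (k ∷ acc ∷ ρ)) (G Z ρ) (B Z ρ) ∎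
  where
  open ≡-Reasoning
  args : Fin (suc n) → Real → Vec ℕ n → ℕ
  args 0F           = B
  args (Fin.suc i)  = λ Z ρ → lookup ρ i
  argsPR : ∀ i → PRFun n (args i)
  argsPR 0F          = b
  argsPR (Fin.suc i) = pr-var i

pr-weaken₂ : ∀ {n F} → PRFun (suc n) F → PRFun (suc (suc n)) (λ Z ρ → F Z (head ρ ∷ tail (tail ρ)))
pr-weaken₂ {n} {F} f = pr-resp (pr-compose {G = args} f argsPR)
  λ { Z (x ∷ y ∷ ρ) → cong (λ ρ′ → F Z (x ∷ ρ′)) (tabulate∘lookup ρ) }
  where
  args : Fin (suc n) → Real → Vec ℕ (suc (suc n)) → ℕ
  args 0F          = λ Z ρ → lookup ρ 0F
  args (Fin.suc i) = λ Z ρ → lookup ρ (Fin.suc (Fin.suc i))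
  argsPR : ∀ i → PRFun (suc (suc n)) (args i)
  argsPR 0F          = pr-var 0F
  argsPR (Fin.suc i) = pr-var (Fin.suc (Fin.suc i))

isZero : ℕ → ℕ
isZero zero    = 1
isZero (suc _) = 0

indicator-≤ᵇ : ∀ a b → indicator (a ≤ᵇ b) ≡ isZero (a ∸ b)
indicator-≤ᵇ zero          zero    = refl
indicator-≤ᵇ zero          (suc b) = refl
indicator-≤ᵇ (suc a)       zero    = refl
indicator-≤ᵇ (suc zero)    (suc zero)    = refl
indicator-≤ᵇ (suc zero)    (suc (suc b)) = refl
indicator-≤ᵇ (suc (suc a)) (suc b) = indicator-≤ᵇ (suc a) b

indicator-≡ᵇ : ∀ a b → indicator (a ≡ᵇ b) ≡ isZero ((a ∸ b) + (b ∸ a))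
indicator-≡ᵇ zero    zero    = refl
indicator-≡ᵇ zero    (suc b) = refl
indicator-≡ᵇ (suc a) zero    = refl
indicator-≡ᵇ (suc a) (suc b) = indicator-≡ᵇ a b

private
  plus : PRFun 2 (λ Z ρ → head ρ + head (tail ρ))
  plus = pr-resp (pr-natrec (pr-var 0F) (pr-var 1F) (pr-suc (pr-var 1F)))
    λ { Z (x ∷ y ∷ []) → natrec-unique (_+ y) refl (λ _ → refl) x }

pr-+ : ∀ {n A B} → PRFun n A → PRFun n B → PRFun n (λ Z ρ → A Z ρ + B Z ρ)
pr-+ = pr-apply₂ {f = _+_} plus

private
  times : PRFun 2 (λ Z ρ → head ρ * head (tail ρ))
  times = pr-resp (pr-natrec (pr-var 0F) pr-zero (pr-+ (pr-var 3F) (pr-var 1F)))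
    λ { Z (x ∷ y ∷ []) → natrec-unique (_* y) refl (λ _ → refl) x }

pr-* : ∀ {n A B} → PRFun n A → PRFun n B → PRFun n (λ Z ρ → A Z ρ * B Z ρ)
pr-* = pr-apply₂ {f = _*_} times

private
  predecessor : PRFun 1 (λ Z ρ → pred (head ρ))
  predecessor = pr-resp (pr-natrec (pr-var 0F) pr-zero (pr-var 0F))
    λ { Z (x ∷ []) → natrec-unique pred refl (λ _ → refl) x }

pr-pred : ∀ {n A} → PRFun n A → PRFun n (λ Z ρ → pred (A Z ρ))
pr-pred = pr-apply₁ {f = pred} predecessor

private
  monus : PRFun 2 (λ Z ρ → head ρ ∸ head (tail ρ))
  monus = pr-resp (pr-natrec (pr-var 1F) (pr-var 0F) (pr-pred (pr-var 1F)))
    λ { Z (x ∷ y ∷ []) → natrec-unique (x ∸_) refl (λ k → sym (pred[m∸n]≡m∸[1+n] x k)) y }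

pr-∸ : ∀ {n A B} → PRFun n A → PRFun n B → PRFun n (λ Z ρ → A Z ρ ∸ B Z ρ)
pr-∸ = pr-apply₂ {f = _∸_} monus

private
  power : PRFun 1 (λ Z ρ → 2 ^ head ρ)
  power = pr-resp (pr-natrec (pr-var 0F) (pr-const 1) (pr-* (pr-const 2) (pr-var 1F)))
    λ { Z (x ∷ []) → natrec-unique (2 ^_) refl (λ _ → refl) x }

pr-2^ : ∀ {n A} → PRFun n A → PRFun n (λ Z ρ → 2 ^ A Z ρ)
pr-2^ = pr-apply₁ {f = 2 ^_} power

private
  zeroTest : PRFun 1 (λ Z ρ → isZero (head ρ))
  zeroTest = pr-resp (pr-natrec (pr-var 0F) (pr-const 1) pr-zero)
    λ { Z (x ∷ []) → natrec-unique isZero refl (λ _ → refl) x }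

pr-≤ᵇ : ∀ {n A B} → PRFun n A → PRFun n B → PRFun n (λ Z ρ → indicator (A Z ρ ≤ᵇ B Z ρ))
pr-≤ᵇ {A = A} {B} a b =
  pr-resp (pr-apply₁ {f = isZero} zeroTest (pr-∸ a b)) (λ Z ρ → sym (indicator-≤ᵇ (A Z ρ) (B Z ρ)))

pr-≡ᵇ : ∀ {n A B} → PRFun n A → PRFun n B → PRFun n (λ Z ρ → indicator (A Z ρ ≡ᵇ B Z ρ))
pr-≡ᵇ {A = A} {B} a b = pr-resp (pr-apply₁ {f = isZero} zeroTest (pr-+ (pr-∸ a b) (pr-∸ b a)))
  (λ Z ρ → sym (indicator-≡ᵇ (A Z ρ) (B Z ρ)))

pr-∑< : ∀ {n B F} → PRFun n B → PRFun (suc n) F → PRFun n (λ Z ρ → ∑< (B Z ρ) (λ p → F Z (p ∷ ρ)))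
pr-∑< {B = B} {F} b f = pr-resp (pr-natrec b pr-zero (pr-+ (pr-var 1F) (pr-weaken₂ f)))
  λ Z ρ → natrec-unique (λ k → ∑< k (λ p → F Z (p ∷ ρ))) refl (λ _ → refl) (B Z ρ)

private
  mod2 : PRFun 1 (λ Z ρ → head ρ % 2)
  mod2 = pr-resp (pr-natrec (pr-var 0F) pr-zero (pr-∸ (pr-const 1) (pr-var 1F)))
    λ { Z (x ∷ []) → natrec-unique (_% 2) refl [1+m]%2≡1∸m%2 x }

  div2 : PRFun 1 (λ Z ρ → head ρ / 2)
  div2 = pr-resp (pr-natrec (pr-var 0F) pr-zero (pr-+ (pr-var 1F) (pr-apply₁ {f = _% 2} mod2 (pr-var 0F))))
    λ { Z (x ∷ []) → natrec-unique (_/ 2) refl [1+m]/2≡m/2+m%2 x }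

  div2^ : PRFun 2 (λ Z ρ → head ρ /2^ head (tail ρ))
  div2^ = pr-resp (pr-natrec (pr-var 1F) (pr-var 0F) (pr-apply₁ {f = _/ 2} div2 (pr-var 1F)))
    λ { Z (m ∷ k ∷ []) → natrec-unique (m /2^_) (n/1≡n m) (m/2^[1+k]≡m/2^k/2 m) k }

pr-/2 : ∀ {n A} → PRFun n A → PRFun n (λ Z ρ → A Z ρ / 2)
pr-/2 = pr-apply₁ {f = _/ 2} div2

pr-/2^ : ∀ {n A B} → PRFun n A → PRFun n B → PRFun n (λ Z ρ → A Z ρ /2^ B Z ρ)
pr-/2^ = pr-apply₂ {f = _/2^_} div2^

pr-%2^ : ∀ {n A B} → PRFun n A → PRFun n B → PRFun n (λ Z ρ → A Z ρ %2^ B Z ρ)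
pr-%2^ {A = A} {B} a b = pr-resp (pr-∸ a (pr-* (pr-/2^ a b) (pr-2^ b)))
  (λ Z ρ → sym (m%n≡m∸m/n*n (A Z ρ) (2 ^ B Z ρ) {{m^n≢0 2 (B Z ρ)}}))

pr-bit : ∀ {n K M} → PRFun n K → PRFun n M → PRFun n (λ Z ρ → indicator (bit (K Z ρ) (M Z ρ)))
pr-bit {K = K} {M} k m =
  pr-resp (pr-apply₁ {f = _% 2} mod2 (pr-/2^ m k)) (λ Z ρ → sym (indicator-bit (K Z ρ) (M Z ρ)))

pr-countBits : ∀ {n N M} → PRFun n N → PRFun n M → PRFun n (λ Z ρ → countBits (N Z ρ) (M Z ρ))
pr-countBits {N = N} {M} k m =
  pr-resp (pr-∑< k (pr-bit (pr-var 0F) (pr-weaken m))) (λ Z ρ → sym (countBits≡∑< (N Z ρ) (M Z ρ)))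

toPrimRec : ∀ {f : ℕ → ℕ} → PRFun 1 (λ Z ρ → f (lookup ρ 0F)) → PrimRec f
toPrimRec (t , t≡f) = t , λ Z x → t≡f Z (x ∷ [])

PrimRec-∘ : ∀ {f g : ℕ → ℕ} → PrimRec f → PRFun 1 (λ Z ρ → g (lookup ρ 0F)) → PrimRec (λ x → f (g x))
PrimRec-∘ f-pr g-pr = toPrimRec (pr-primRec f-pr g-pr)

pr-codeOf : ∀ {n L V} → PRFun n L → PRFun n V → PRFun n (λ Z ρ → codeOf (L Z ρ) (V Z ρ))
pr-codeOf l v = pr-+ (pr-pred (pr-2^ l)) v

m∸[m∸n]≡m⊓n : ∀ m n → m ∸ (m ∸ n) ≡ m ⊓ n
m∸[m∸n]≡m⊓n m n with m ≤? n
... | yes m≤n = trans (cong (m ∸_) (m≤n⇒m∸n≡0 m≤n)) (sym (m≤n⇒m⊓n≡m m≤n))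
... | no  m≰n = trans (m∸[m∸n]≡n (<⇒≤ (≰⇒> m≰n))) (sym (m≥n⇒m⊓n≡n (<⇒≤ (≰⇒> m≰n))))

pr-⊓ : ∀ {n A B} → PRFun n A → PRFun n B → PRFun n (λ Z ρ → A Z ρ ⊓ B Z ρ)
pr-⊓ {A = A} {B} a b = pr-resp (pr-∸ a (pr-∸ a b)) (λ Z ρ → m∸[m∸n]≡m⊓n (A Z ρ) (B Z ρ))

pr-lengthOfCode : ∀ {n A} → PRFun n A → PRFun n (λ Z ρ → lengthOfCode (A Z ρ))
pr-lengthOfCode a = pr-∑< a (pr-≤ᵇ (pr-2^ (pr-suc (pr-var 0F))) (pr-suc (pr-weaken a)))

pr-valueOfCode : ∀ {n A} → PRFun n A → PRFun n (λ Z ρ → valueOfCode (A Z ρ))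
pr-valueOfCode a = pr-∸ (pr-suc a) (pr-2^ (pr-lengthOfCode a))

-- Rationals as numerator/denominator pairs

-- frac a b = a / (1 + b), the shape of the values of martingales in Defs.  It is opaque because
-- unification would otherwise unfold the gcd normalisation of _/_.
opaque
  frac : ℕ → ℕ → ℚ
  frac a b = fromℚᵘ (mkℚᵘ (ℤ.+ a) b)

  frac-def : ∀ a b → frac a b ≡ ℤ.+ a ℚ./ suc b
  frac-def a b = refl

  toℚᵘ-frac : ∀ a b → toℚᵘ (frac a b) ≃ᵘ mkℚᵘ (ℤ.+ a) b
  toℚᵘ-frac a b = ℚP.toℚᵘ-fromℚᵘ (mkℚᵘ (ℤ.+ a) b)

  frac-0-0 : frac 0 0 ≡ 0ℚ
  frac-0-0 = refl

  frac-1-0 : frac 1 0 ≡ 1ℚ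
  frac-1-0 = refl

-- suc (mulDen b d) reduces to suc b * suc d.
mulDen : ℕ → ℕ → ℕ
mulDen b d = d + b * suc d

frac-mono-≤ : ∀ {a b c d} → a * suc d ≤ c * suc b → frac a b ℚ.≤ frac c d
frac-mono-≤ {a} {b} {c} {d} h = ℚP.toℚᵘ-cancel-≤
  (ℚᵘP.≤-respʳ-≃ (ℚᵘP.≃-sym (toℚᵘ-frac c d)) (ℚᵘP.≤-respˡ-≃ (ℚᵘP.≃-sym (toℚᵘ-frac a b))
    (*≤* (subst₂ ℤ._≤_ (ℤP.pos-* a (suc d)) (ℤP.pos-* c (suc b)) (ℤ.+≤+ h)))))

frac-cancel-≤ : ∀ {a b c d} → frac a b ℚ.≤ frac c d → a * suc d ≤ c * suc b
frac-cancel-≤ {a} {b} {c} {d} h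
  with ℚᵘP.≤-respʳ-≃ (toℚᵘ-frac c d) (ℚᵘP.≤-respˡ-≃ (toℚᵘ-frac a b) (ℚP.toℚᵘ-mono-≤ h))
... | *≤* q = ℤP.drop‿+≤+ (subst₂ ℤ._≤_ (sym (ℤP.pos-* a (suc d))) (sym (ℤP.pos-* c (suc b))) q)

frac-cong : ∀ {a b c d} → a * suc d ≡ c * suc b → frac a b ≡ frac c d
frac-cong e = ℚP.≤-antisym (frac-mono-≤ (≤-reflexive e)) (frac-mono-≤ (≤-reflexive (sym e)))

frac-+ : ∀ a b c d → frac a b ℚ.+ frac c d ≡ frac (a * suc d + c * suc b) (mulDen b d)
frac-+ a b c d = ℚP.toℚᵘ-injective (ℚᵘP.≃-trans (ℚP.toℚᵘ-homo-+ (frac a b) (frac c d))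
  (ℚᵘP.≃-trans (ℚᵘP.+-cong (toℚᵘ-frac a b) (toℚᵘ-frac c d))
  (ℚᵘP.≃-trans (ℚᵘP.≃-reflexive (cong (λ z → mkℚᵘ z (mulDen b d)) numerator))
                (ℚᵘP.≃-sym (toℚᵘ-frac _ _)))))
  where
  numerator : ℤ.+ a ℤ.* ℤ.+ suc d ℤ.+ ℤ.+ c ℤ.* ℤ.+ suc b ≡ ℤ.+ (a * suc d + c * suc b)
  numerator = sym (trans (ℤP.pos-+ (a * suc d) (c * suc b))
                         (cong₂ ℤ._+_ (ℤP.pos-* a (suc d)) (ℤP.pos-* c (suc b))))

frac-* : ∀ a b c d → frac a b ℚ.* frac c d ≡ frac (a * c) (mulDen b d)
frac-* a b c d = ℚP.toℚᵘ-injective (ℚᵘP.≃-trans (ℚP.toℚᵘ-homo-* (frac a b) (frac c d))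
  (ℚᵘP.≃-trans (ℚᵘP.*-cong (toℚᵘ-frac a b) (toℚᵘ-frac c d))
  (ℚᵘP.≃-trans (ℚᵘP.≃-reflexive (cong (λ z → mkℚᵘ z (mulDen b d)) (sym (ℤP.pos-* a c))))
                (ℚᵘP.≃-sym (toℚᵘ-frac _ _)))))

frac-complement : ∀ {a b c} → a + c ≡ suc b → frac a b ℚ.+ frac c b ≡ 1ℚ
frac-complement {a} {b} {c} a+c≡1+b = trans (frac-+ a b c b) (trans (frac-cong (begin
  (a * suc b + c * suc b) * 1  ≡⟨ *-identityʳ _ ⟩
  a * suc b + c * suc b        ≡⟨ *-distribʳ-+ (suc b) a c ⟨
  (a + c) * suc b              ≡⟨ cong (_* suc b) a+c≡1+b ⟩
  suc b * suc b                ≡⟨ *-identityˡ _ ⟨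
  1 * suc (mulDen b b)         ∎)) frac-1-0)
  where open ≡-Reasoning

0≤frac : ∀ a b → 0ℚ ℚ.≤ frac a b
0≤frac a b = subst (ℚ._≤ frac a b) frac-0-0 (frac-mono-≤ z≤n)

0≤+ : ∀ {p q} → 0ℚ ℚ.≤ p → 0ℚ ℚ.≤ q → 0ℚ ℚ.≤ p ℚ.+ q
0≤+ {p} {q} 0≤p 0≤q = subst (ℚ._≤ p ℚ.+ q) (ℚP.+-identityʳ 0ℚ) (ℚP.+-mono-≤ 0≤p 0≤q)

0≤* : ∀ {p q} → 0ℚ ℚ.≤ p → 0ℚ ℚ.≤ q → 0ℚ ℚ.≤ p ℚ.* q
0≤* {p} {q} 0≤p 0≤q =
  ℚP.nonNegative⁻¹ _ {{ℚP.nonNeg*nonNeg⇒nonNeg p {{ℚ.nonNegative 0≤p}} q {{ℚ.nonNegative 0≤q}}}}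

q≤p+q : ∀ {p} q → 0ℚ ℚ.≤ p → q ℚ.≤ p ℚ.+ q
q≤p+q {p} q 0≤p = subst (ℚ._≤ p ℚ.+ q) (ℚP.+-identityˡ q) (ℚP.+-monoˡ-≤ q 0≤p)

ι : ℕ → ℚ
ι a = frac a 0

ι-+ : ∀ a b → ι a ℚ.+ ι b ≡ ι (a + b)
ι-+ a b = trans (frac-+ a 0 b 0) (cong (λ x → frac x 0) (cong₂ _+_ (*-identityʳ a) (*-identityʳ b)))

ι-* : ∀ a b → ι a ℚ.* ι b ≡ ι (a * b)
ι-* a b = frac-* a 0 b 0

ι-mono-≤ : ∀ {a b} → a ≤ b → ι a ℚ.≤ ι b
ι-mono-≤ {a} {b} a≤b = frac-mono-≤ (*-monoˡ-≤ 1 a≤b)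

*suc≤⇒ι≤frac : ∀ {a b c} → a * suc b ≤ c → ι a ℚ.≤ frac c b
*suc≤⇒ι≤frac {a} {b} {c} h = frac-mono-≤ (subst (a * suc b ≤_) (sym (*-identityʳ c)) h)

ι≤frac⇒*suc≤ : ∀ {a b c} → ι a ℚ.≤ frac c b → a * suc b ≤ c
ι≤frac⇒*suc≤ {a} {b} {c} h = subst (a * suc b ≤_) (*-identityʳ c) (frac-cancel-≤ h)

ι-cancel-≤ : ∀ {a b} → ι a ℚ.≤ ι b → a ≤ b
ι-cancel-≤ {a} {b} h = subst₂ _≤_ (*-identityʳ a) (*-identityʳ b) (frac-cancel-≤ h)

½^ : ℕ → ℚ
½^ j = frac 1 (pred (2 ^ j))

ι*½^ : ∀ a j → ι a ℚ.* ½^ j ≡ frac a (pred (2 ^ j))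
ι*½^ a j = trans (frac-* a 0 1 (pred (2 ^ j))) (cong₂ frac (*-identityʳ a) (+-identityʳ (pred (2 ^ j))))

½^-split : ∀ j → ½^ j ≡ ½^ (suc j) ℚ.+ ½^ (suc j)
½^-split j = sym (trans (frac-+ 1 b 1 b) (frac-cong (begin
  (1 * suc b + 1 * suc b) * suc (pred (2 ^ j))
    ≡⟨ cong₂ (λ x y → (1 * x + 1 * x) * y) (suc-pred[2^ℓ] (suc j)) (suc-pred[2^ℓ] j) ⟩
  (1 * (2 * 2 ^ j) + 1 * (2 * 2 ^ j)) * 2 ^ j
    ≡⟨ ring (2 ^ j) ⟩
  1 * (2 * 2 ^ j * (2 * 2 ^ j))
    ≡⟨ cong (λ x → 1 * (x * x)) (suc-pred[2^ℓ] (suc j)) ⟨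
  1 * (suc b * suc b)
    ∎)))
  where
  open ≡-Reasoning
  b : ℕ
  b = pred (2 ^ suc j)
  ring : ∀ t → (1 * (2 * t) + 1 * (2 * t)) * t ≡ 1 * (2 * t * (2 * t))
  ring = solve-∀

½^-zero : ½^ 0 ≡ 1ℚ
½^-zero = frac-1-0

½^-weight : ∀ k → ½^ (suc k) ℚ.* ι (2 ^ k * 2 ^ suc k) ≡ ι (2 ^ k)
½^-weight k = begin
  ½^ (suc k) ℚ.* ι (2 ^ k * 2 ^ suc k)
    ≡⟨ ℚP.*-comm (½^ (suc k)) _ ⟩
  ι (2 ^ k * 2 ^ suc k) ℚ.* ½^ (suc k)
    ≡⟨ ι*½^ (2 ^ k * 2 ^ suc k) (suc k) ⟩
  frac (2 ^ k * 2 ^ suc k) (pred (2 ^ suc k))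
    ≡⟨ frac-cong (trans (*-identityʳ _) (cong (2 ^ k *_) (sym (suc-pred[2^ℓ] (suc k))))) ⟩
  ι (2 ^ k)
    ∎
  where open ≡-Reasoning

0≤½^ : ∀ j → 0ℚ ℚ.≤ ½^ j
0≤½^ j = 0≤frac 1 (pred (2 ^ j))

open MonoidSum ℚP.+-0-commutativeMonoid using ()
  renaming (∑< to ∑ℚ<; ∑<-cong to ∑ℚ<-cong; ∑<-split to ∑ℚ<-split; ∑<-distrib to ∑ℚ<-distrib)

∑ℚ<-mono-≤ : ∀ B {f g : ℕ → ℚ} → (∀ p → p < B → f p ℚ.≤ g p) → ∑ℚ< B f ℚ.≤ ∑ℚ< B g
∑ℚ<-mono-≤ zero    f≤g = ℚP.≤-refl
∑ℚ<-mono-≤ (suc B) f≤g = ℚP.+-mono-≤ (∑ℚ<-mono-≤ B (λ p p<B → f≤g p (m<n⇒m<1+n p<B))) (f≤g B ≤-refl)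

0≤∑ℚ< : ∀ B {f : ℕ → ℚ} → (∀ p → 0ℚ ℚ.≤ f p) → 0ℚ ℚ.≤ ∑ℚ< B f
0≤∑ℚ< zero    0≤f = ℚP.≤-refl
0≤∑ℚ< (suc B) 0≤f = ℚP.+-mono-≤ (0≤∑ℚ< B 0≤f) (0≤f B)

term≤∑ℚ< : ∀ B (f : ℕ → ℚ) {q} → q < B → (∀ p → 0ℚ ℚ.≤ f p) → f q ℚ.≤ ∑ℚ< B f
term≤∑ℚ< B f {q} q<B 0≤f = begin
  f q
    ≤⟨ q≤p+q (f q) (0≤∑ℚ< q 0≤f) ⟩
  ∑ℚ< (suc q) f
    ≡⟨ ℚP.+-identityʳ _ ⟨
  ∑ℚ< (suc q) f ℚ.+ 0ℚ
    ≤⟨ ℚP.+-monoʳ-≤ (∑ℚ< (suc q) f) (0≤∑ℚ< (B ∸ suc q) (λ p → 0≤f (suc q + p))) ⟩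
  ∑ℚ< (suc q) f ℚ.+ ∑ℚ< (B ∸ suc q) (λ p → f (suc q + p))
    ≡⟨ ∑ℚ<-split (suc q) (B ∸ suc q) f ⟨
  ∑ℚ< (suc q + (B ∸ suc q)) f
    ≡⟨ cong (λ k → ∑ℚ< k f) (m+[n∸m]≡n q<B) ⟩
  ∑ℚ< B f
    ∎
  where open ℚP.≤-Reasoning

ι-∑< : ∀ B (f : ℕ → ℕ) → ∑ℚ< B (λ p → ι (f p)) ≡ ι (∑< B f)
ι-∑< zero    f = sym frac-0-0
ι-∑< (suc B) f = trans (cong (ℚ._+ ι (f B)) (ι-∑< B f)) (ι-+ (∑< B f) (f B))

record PRℚ (n : ℕ) (q : Real → Vec ℕ n → ℚ) : Set where
  field
    num den : Real → Vec ℕ n → ℕ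
    num-pr  : PRFun n num
    den-pr  : PRFun n den
    frac≡   : ∀ Z ρ → frac (num Z ρ) (den Z ρ) ≡ q Z ρ

module _ {n : ℕ} where

  prℚ-frac : ∀ {A B} → PRFun n A → PRFun n B → PRℚ n (λ Z ρ → frac (A Z ρ) (B Z ρ))
  prℚ-frac a b = record { num-pr = a ; den-pr = b ; frac≡ = λ _ _ → refl }

  pr-mulDen : ∀ {B D} → PRFun n B → PRFun n D → PRFun n (λ Z ρ → mulDen (B Z ρ) (D Z ρ))
  pr-mulDen b d = pr-+ d (pr-* b (pr-suc d))

  prℚ-+ : ∀ {q r} → PRℚ n q → PRℚ n r → PRℚ n (λ Z ρ → q Z ρ ℚ.+ r Z ρ)
  prℚ-+ Q R = record
    { num-pr = pr-+ (pr-* Q.num-pr (pr-suc R.den-pr)) (pr-* R.num-pr (pr-suc Q.den-pr))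
    ; den-pr = pr-mulDen Q.den-pr R.den-pr
    ; frac≡  = λ Z ρ → trans (sym (frac-+ _ _ _ _)) (cong₂ ℚ._+_ (Q.frac≡ Z ρ) (R.frac≡ Z ρ))
    }
    where
    module Q = PRℚ Q
    module R = PRℚ R

  prℚ-* : ∀ {q r} → PRℚ n q → PRℚ n r → PRℚ n (λ Z ρ → q Z ρ ℚ.* r Z ρ)
  prℚ-* Q R = record
    { num-pr = pr-* Q.num-pr R.num-pr
    ; den-pr = pr-mulDen Q.den-pr R.den-pr
    ; frac≡  = λ Z ρ → trans (sym (frac-* _ _ _ _)) (cong₂ ℚ._*_ (Q.frac≡ Z ρ) (R.frac≡ Z ρ))
    }
    where
    module Q = PRℚ Q
    module R = PRℚ R

prℚ-ι : ∀ {n A} → PRFun n A → PRℚ n (λ Z ρ → ι (A Z ρ))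
prℚ-ι a = prℚ-frac a pr-zero

prℚ-½^ : ∀ {n J} → PRFun n J → PRℚ n (λ Z ρ → ½^ (J Z ρ))
prℚ-½^ j = prℚ-frac (pr-const 1) (pr-pred (pr-2^ j))

prℚ-∑< : ∀ {n B q} → PRFun n B → PRℚ (suc n) q → PRℚ n (λ Z ρ → ∑ℚ< (B Z ρ) (λ k → q Z (k ∷ ρ)))
prℚ-∑< {n} {B} {q} b Q = record
  { num-pr = pr-natrec b pr-zero (pr-+ (pr-* (pr-var 1F) (pr-suc (pr-weaken₂ Q.den-pr)))
                                       (pr-* (pr-weaken₂ Q.num-pr) (pr-suc (pr-weaken₂ D-pr))))
  ; den-pr = pr-natrec b pr-zero (pr-mulDen (pr-var 1F) (pr-weaken₂ Q.den-pr))
  ; frac≡  = λ Z ρ → sum≡ Z ρ (B Z ρ)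
  }
  where
  module Q = PRℚ Q
  D : Real → Vec ℕ n → ℕ → ℕ
  D Z ρ = natrec (λ k acc → mulDen acc (Q.den Z (k ∷ ρ))) 0
  N : Real → Vec ℕ n → ℕ → ℕ
  N Z ρ = natrec (λ k acc → acc * suc (Q.den Z (k ∷ ρ)) + Q.num Z (k ∷ ρ) * suc (D Z ρ k)) 0
  D-pr : PRFun (suc n) (λ Z ρ → D Z (tail ρ) (lookup ρ 0F))
  D-pr = pr-natrec (pr-var 0F) pr-zero (pr-mulDen (pr-var 1F) (pr-weaken₂ (pr-weaken₂ Q.den-pr)))
  sum≡ : ∀ Z ρ K → frac (N Z ρ K) (D Z ρ K) ≡ ∑ℚ< K (λ k → q Z (k ∷ ρ))
  sum≡ Z ρ zero    = frac-0-0
  sum≡ Z ρ (suc K) = trans (sym (frac-+ _ _ _ _)) (cong₂ ℚ._+_ (sum≡ Z ρ K) (Q.frac≡ Z (K ∷ ρ)))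

-- Martin-Löf tests given by primitive recursive sets of strings

module SetTest
  (F : ℕ → ℕ) (F-pr : PrimRec F) (member : Real → ℕ → ℕ → Bool)
  (member-pr : ∀ {m N P} → PRFun m N → PRFun m P →
               PRFun m (λ Z ρ → indicator (member Z (N Z ρ) (P Z ρ))))
  (sparse : ∀ Z n → ∑< (2 ^ F n) (λ p → indicator (member Z n p)) * 2 ^ n < 2 ^ F n)
  where

  -- The canonical code of {p < 2 ^ F n ∣ member Z n p} is the value of its string of membership bits.
  setCode : Real → ℕ → ℕ
  setCode Z n = val (applyUpTo (member Z n) (2 ^ F n))

  setCode-pr : PRFun 1 (λ Z ρ → setCode Z (head ρ))
  setCode-pr = pr-resp
    (pr-∑< (pr-2^ (pr-primRec F-pr (pr-var 0F)))
           (pr-* (pr-2^ (pr-var 0F)) (member-pr (pr-var 1F) (pr-var 0F))))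
    λ { Z (n ∷ []) → sym (val-applyUpTo (member Z n) (2 ^ F n)) }

  test : PRTest
  test = record
    { g             = proj₁ setCode-pr
    ; f             = F
    ; f-pr          = F-pr
    ; codes-subset  = λ Z n → subst (_< 2 ^ (2 ^ F n)) (sym (code≡ Z n)) (subset Z n)
    ; measure-small = λ Z n →
        subst (λ m → countBits (2 ^ F n) m * 2 ^ n < 2 ^ F n) (sym (code≡ Z n)) (small Z n)
    }
    where
    code≡ : ∀ Z n → proj₁ setCode-pr ⟦ Z ⟧ n ≡ setCode Z n
    code≡ Z n = proj₂ setCode-pr Z (n ∷ [])
    subset : ∀ Z n → setCode Z n < 2 ^ (2 ^ F n)
    subset Z n = subst (λ ℓ → setCode Z n < 2 ^ ℓ) (length-applyUpTo (member Z n) (2 ^ F n))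
                       (val<2^length (applyUpTo (member Z n) (2 ^ F n)))
    small : ∀ Z n → countBits (2 ^ F n) (setCode Z n) * 2 ^ n < 2 ^ F n
    small Z n = subst (λ c → c * 2 ^ n < 2 ^ F n) (sym (countBits-val-applyUpTo (member Z n) (2 ^ F n)))
                      (sparse Z n)

  test-covers : ∀ {Y X n} → T (member Y n (val (X ↾ F n))) → inCyl test Y X n
  test-covers {Y} {X} {n} t = begin
    bit v (proj₁ setCode-pr ⟦ Y ⟧ n) ≡⟨ cong (bit v) (proj₂ setCode-pr Y (n ∷ [])) ⟩
    bit v (setCode Y n)              ≡⟨ bit-val-applyUpTo (member Y n) (val-↾<2^ X (F n)) ⟩
    member Y n v                     ≡⟨ Equivalence.to T-≡ t ⟩
    true                             ∎
    where
    open ≡-Reasoning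
    v : ℕ
    v = val (X ↾ F n)

countBits-monoˡ-≤ : ∀ G {p q} → p ≤ q → countBits p G ≤ countBits q G
countBits-monoˡ-≤ G {p} {q} p≤q =
  subst₂ _≤_ (sym (countBits≡∑< p G)) (sym (countBits≡∑< q G)) (∑<-monoˡ-≤ (λ k → indicator (bit k G)) p≤q)

countBits<countBits : ∀ {p q G} → p < q → bit p G ≡ true → countBits p G < countBits q G
countBits<countBits {p} {q} {G} p<q bit≡true = ≤-trans (≤-reflexive (sym suc-count)) (countBits-monoˡ-≤ G p<q)
  where
  suc-count : countBits (suc p) G ≡ suc (countBits p G)
  suc-count rewrite bit≡true = +-comm (countBits p G) 1

select : ℕ → ℕ → ℕ → (ℕ → ℕ) → ℕ
select K G i h = ∑< K (λ p → indicator (bit p G) * indicator (countBits p G ≡ᵇ i) * h p)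

-- A member of G is recovered from its rank, i.e. the number of smaller members.
select-countBits : ∀ {K G v} (h : ℕ → ℕ) → v < K → bit v G ≡ true → select K G (countBits v G) h ≡ h v
select-countBits {K} {G} {v} h v<K v∈G = trans (∑<-single K _ v<K others) at-v
  where
  at-v : indicator (bit v G) * indicator (countBits v G ≡ᵇ countBits v G) * h v ≡ h v
  at-v rewrite v∈G | indicator-T (≡⇒≡ᵇ (countBits v G) (countBits v G) refl) = +-identityʳ (h v)
  ranks-differ : ∀ {p} → bit p G ≡ true → p ≢ v → countBits p G ≢ countBits v G
  ranks-differ {p} p∈G p≢v with <-cmp p v
  ... | tri< p<v _ _ = <⇒≢ (countBits<countBits p<v p∈G)
  ... | tri≈ _ p≡v _ = contradiction p≡v p≢v
  ... | tri> _ _ v<p = ≢-sym (<⇒≢ (countBits<countBits v<p v∈G))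
  others : ∀ p → p < K → p ≢ v → indicator (bit p G) * indicator (countBits p G ≡ᵇ countBits v G) * h p ≡ 0
  others p _ p≢v with bit p G in p∈G
  ... | false = refl
  ... | true  = cong (λ x → 1 * x * h p) (indicator-≡ᵇ-≢ (ranks-differ p∈G p≢v))

-- Compression versus Martin-Löf tests

Compressible : Real → Real → Set
Compressible X Y = Σ (PR 1) λ M → Σ (ℕ → ℕ) λ f → PrimRec f ×
  (∀ c → Σ Str λ σ → (length σ + c ≤ f c) × (M ⟦ Y ⟧ code σ ≡ code (X ↾ f c)))

Covered : Real → Real → Set
Covered X Y = Σ PRTest λ T → ∀ n → inCyl T Y X n

∑<-indicator≤1 : ∀ K (P : ℕ → Bool) → (∀ {p q} → p < K → q < K → T (P p) → T (P q) → p ≡ q) →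
                 ∑< K (λ p → indicator (P p)) ≤ 1
∑<-indicator≤1 zero    P unique = z≤n
∑<-indicator≤1 (suc K) P unique with P K in PK
... | false = subst (_≤ 1) (sym (+-identityʳ _))
                (∑<-indicator≤1 K P (λ p<K q<K → unique (m<n⇒m<1+n p<K) (m<n⇒m<1+n q<K)))
... | true  = ≤-reflexive (cong (_+ 1) (∑<-ε K (λ p p<K → indicator-¬T (λ t →
                <⇒≢ p<K (unique (m<n⇒m<1+n p<K) ≤-refl t (subst T (sym PK) _))))))

indicator[1≤ᵇ]≤ : ∀ h → indicator (1 ≤ᵇ h) ≤ h
indicator[1≤ᵇ]≤ zero    = z≤n
indicator[1≤ᵇ]≤ (suc h) = s≤s z≤n

suc-code<2^suc-length : ∀ s → suc (code s) < 2 ^ suc (length s)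
suc-code<2^suc-length s = begin-strict
  suc (code s)                 ≡⟨ suc-code s ⟩
  2 ^ length s + val s         <⟨ +-monoʳ-< (2 ^ length s) (val<2^length s) ⟩
  2 ^ length s + 2 ^ length s  ≡⟨ cong (2 ^ length s +_) (+-identityʳ (2 ^ length s)) ⟨
  2 ^ suc (length s)           ∎
  where open ≤-Reasoning

module CompressionTest (M : PR 1) (f : ℕ → ℕ) (f-pr : PrimRec f) where

  F : ℕ → ℕ
  F n = f (suc n)

  -- The codes of the strings of length < F n ∸ n.
  shortCodes : ℕ → ℕ
  shortCodes n = pred (2 ^ (F n ∸ n))

  hits : Real → ℕ → ℕ → ℕ
  hits Z n p = ∑< (shortCodes n) (λ N → indicator (M ⟦ Z ⟧ N ≡ᵇ codeOf (F n) p))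

  member : Real → ℕ → ℕ → Bool
  member Z n p = 1 ≤ᵇ hits Z n p

  member-pr : ∀ {m N P} → PRFun m N → PRFun m P → PRFun m (λ Z ρ → indicator (member Z (N Z ρ) (P Z ρ)))
  member-pr n p = pr-≤ᵇ (pr-const 1)
    (pr-∑< (pr-pred (pr-2^ (pr-∸ (F-pr n) n)))
           (pr-≡ᵇ (pr-term M (pr-var 0F)) (pr-codeOf (F-pr (pr-weaken n)) (pr-weaken p))))
    where
    F-pr : ∀ {m N} → PRFun m N → PRFun m (λ Z ρ → F (N Z ρ))
    F-pr n = pr-primRec f-pr (pr-suc n)

  hit-unique : ∀ Z n N {p q} → T (M ⟦ Z ⟧ N ≡ᵇ codeOf (F n) p) → T (M ⟦ Z ⟧ N ≡ᵇ codeOf (F n) q) → p ≡ q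
  hit-unique Z n N {p} {q} MN≡p MN≡q = +-cancelˡ-≡ (pred (2 ^ F n)) p q
    (trans (sym (≡ᵇ⇒≡ (M ⟦ Z ⟧ N) (codeOf (F n) p) MN≡p)) (≡ᵇ⇒≡ (M ⟦ Z ⟧ N) (codeOf (F n) q) MN≡q))

  sparse : ∀ Z n → ∑< (2 ^ F n) (λ p → indicator (member Z n p)) * 2 ^ n < 2 ^ F n
  sparse Z n = *2^<2^ (F n) n (begin
    ∑< (2 ^ F n) (λ p → indicator (member Z n p))
      ≤⟨ ∑<-mono-≤ (2 ^ F n) (λ p _ → indicator[1≤ᵇ]≤ (hits Z n p)) ⟩
    ∑< (2 ^ F n) (hits Z n)
      ≡⟨ ∑<-swap (2 ^ F n) (shortCodes n) _ ⟩
    ∑< (shortCodes n) (λ N → ∑< (2 ^ F n) (λ p → indicator (M ⟦ Z ⟧ N ≡ᵇ codeOf (F n) p)))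
      ≤⟨ ∑<-mono-≤ (shortCodes n) (λ N _ → ∑<-indicator≤1 (2 ^ F n) _ (λ _ _ → hit-unique Z n N)) ⟩
    ∑< (shortCodes n) (λ _ → 1)
      ≡⟨ trans (∑<-const (shortCodes n) 1) (*-identityʳ (shortCodes n)) ⟩
    shortCodes n ∎)
    where open ≤-Reasoning

  open SetTest F (PrimRec-∘ f-pr (pr-suc (pr-var 0F))) member member-pr sparse public

  compressed⇒member : ∀ {X Y} n → (σ : Str) → length σ + suc n ≤ F n → M ⟦ Y ⟧ code σ ≡ code (X ↾ F n) →
                      T (member Y n (val (X ↾ F n)))
  compressed⇒member {X} {Y} n σ short Mσ≡X = ≤⇒≤ᵇ (begin
    1                                                            ≡⟨ indicator-T (≡⇒≡ᵇ _ _ Mσ≡codeOf) ⟨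
    indicator (M ⟦ Y ⟧ code σ ≡ᵇ codeOf (F n) (val (X ↾ F n)))   ≤⟨ term≤∑< _ code<shortCodes ⟩
    hits Y n (val (X ↾ F n))                                     ∎)
    where
    open ≤-Reasoning
    Mσ≡codeOf : M ⟦ Y ⟧ code σ ≡ codeOf (F n) (val (X ↾ F n))
    Mσ≡codeOf = trans Mσ≡X (code-↾ X (F n))
    code<shortCodes : code σ < shortCodes n
    code<shortCodes = <⇒≤pred (<-≤-trans (suc-code<2^suc-length σ)
      (^-monoʳ-≤ 2 (m+n≤o⇒m≤o∸n (suc (length σ)) (subst (_≤ F n) (+-suc (length σ) n) short))))

compressible⇒covered : ∀ {X Y} → Compressible X Y → Covered X Y
compressible⇒covered (M , f , f-pr , compress) = test , λ n →
  let (σ , short , Mσ≡X) = compress (suc n) in test-covers (compressed⇒member n σ short Mσ≡X)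
  where open CompressionTest M f f-pr

2^[1+c]*y≡2*[2^c*y] : ∀ c y → 2 ^ suc c * y ≡ 2 * (2 ^ c * y)
2^[1+c]*y≡2*[2^c*y] c y = *-assoc 2 (2 ^ c) y

bit-2^*-low : ∀ c y {q} → q < c → bit q (2 ^ c * y) ≡ false
bit-2^*-low (suc c) y {zero}  _         rewrite 2^[1+c]*y≡2*[2^c*y] c y = bit0-2* (2 ^ c * y)
bit-2^*-low (suc c) y {suc q} (s≤s q<c) rewrite 2^[1+c]*y≡2*[2^c*y] c y =
  trans (bit-suc-2* q (2 ^ c * y)) (bit-2^*-low c y q<c)

bit-2^*-odd : ∀ c i → bit c (2 ^ c * suc (2 * i)) ≡ true
bit-2^*-odd zero    i = trans (cong (bit 0) (*-identityˡ (suc (2 * i)))) (bit0-1+2* i)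
bit-2^*-odd (suc c) i rewrite 2^[1+c]*y≡2*[2^c*y] c (suc (2 * i)) =
  trans (bit-suc-2* c (2 ^ c * suc (2 * i))) (bit-2^*-odd c i)

valuation : ℕ → ℕ
valuation x = ∑< x (λ j → indicator (countBits (suc j) x ≡ᵇ 0))

pr-valuation : ∀ {n X} → PRFun n X → PRFun n (λ Z ρ → valuation (X Z ρ))
pr-valuation x = pr-∑< x (pr-≡ᵇ (pr-countBits (pr-suc (pr-var 0F)) (pr-weaken x)) (pr-const 0))

valuation-2^*odd : ∀ c i → valuation (2 ^ c * suc (2 * i)) ≡ c
valuation-2^*odd c i = ∑<-prefix _ c≤x below above
  where
  x : ℕ
  x = 2 ^ c * suc (2 * i)
  c≤x : c ≤ x
  c≤x = ≤-trans (<⇒≤ (n<2^n c)) (m≤m*n (2 ^ c) (suc (2 * i)))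
  below : ∀ j → j < c → indicator (countBits (suc j) x ≡ᵇ 0) ≡ 1
  below j j<c = indicator-T (≡⇒≡ᵇ _ 0 (trans (countBits≡∑< (suc j) x)
    (∑<-ε (suc j) (λ q q≤j → cong indicator (bit-2^*-low c (suc (2 * i)) (<-≤-trans q≤j j<c))))))
  above : ∀ j → c ≤ j → indicator (countBits (suc j) x ≡ᵇ 0) ≡ 0
  above j c≤j = indicator-≡ᵇ-≢ (≢-sym (<⇒≢ (≤-<-trans z≤n (countBits<countBits (s≤s c≤j) (bit-2^*-odd c i)))))

/2^-2^* : ∀ c y → (2 ^ c * y) /2^ c ≡ y
/2^-2^* c y = trans (/-congˡ {{m^n≢0 2 c}} (*-comm (2 ^ c) y)) (m*n/n≡m y (2 ^ c) {{m^n≢0 2 c}})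

suc-pred[2^*suc] : ∀ c y → suc (pred (2 ^ c * suc y)) ≡ 2 ^ c * suc y
suc-pred[2^*suc] c y = suc-pred (2 ^ c * suc y) {{m*n≢0 (2 ^ c) (suc y) {{m^n≢0 2 c}}}}

2^c*odd*2^c≤ : ∀ c i → 2 ^ c * suc (2 * i) * 2 ^ c ≤ suc i * 2 ^ suc (2 * c)
2^c*odd*2^c≤ c i = begin
  2 ^ c * suc (2 * i) * 2 ^ c
    ≤⟨ *-monoˡ-≤ (2 ^ c) (*-monoʳ-≤ (2 ^ c) odd≤even) ⟩
  2 ^ c * (2 * suc i) * 2 ^ c
    ≡⟨ ring (2 ^ c) i ⟩
  suc i * (2 * (2 ^ c * 2 ^ c))
    ≡⟨ cong (λ t → suc i * (2 * t)) (^-distribˡ-+-* 2 c c) ⟨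
  suc i * (2 * 2 ^ (c + c))
    ≡⟨ cong (λ t → suc i * 2 ^ suc t) (cong (c +_) (+-identityʳ c)) ⟨
  suc i * 2 ^ suc (2 * c)
    ∎
  where
  open ≤-Reasoning
  odd≤even : suc (2 * i) ≤ 2 * suc i
  odd≤even = subst (suc (2 * i) ≤_) (sym (*-suc 2 i)) (n≤1+n (suc (2 * i)))
  ring : ∀ a i → a * (2 * suc i) * a ≡ suc i * (2 * (a * a))
  ring = solve-∀

module DecompressionMachine (T : PRTest) where

  open PRTest T

  level : ℕ → ℕ
  level c = suc (2 * c)

  -- An input N is read as N + 1 = 2 ^ c * (2 * i + 1); the output is the member of rank i in G_(2c+1).
  exponent rank : ℕ → ℕ
  exponent N = valuation (suc N)
  rank     N = (suc N /2^ exponent N) / 2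

  input : ℕ → ℕ → ℕ
  input c i = pred (2 ^ c * suc (2 * i))

  machine : Real → ℕ → ℕ
  machine Z N = select (2 ^ F) (g ⟦ Z ⟧ level (exponent N)) (rank N) (codeOf F)
    where
    F : ℕ
    F = f (level (exponent N))

  machine-pr : PRFun 1 (λ Z ρ → machine Z (lookup ρ 0F))
  machine-pr = pr-∑< (pr-2^ F)
    (pr-* (pr-* (pr-bit (pr-var 0F) (pr-weaken G))
                (pr-≡ᵇ (pr-countBits (pr-var 0F) (pr-weaken G)) (pr-weaken i)))
          (pr-codeOf (pr-weaken F) (pr-var 0F)))
    where
    c : PRFun 1 (λ Z ρ → exponent (lookup ρ 0F))
    c = pr-valuation (pr-suc (pr-var 0F))
    i : PRFun 1 (λ Z ρ → rank (lookup ρ 0F))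
    i = pr-/2 (pr-/2^ (pr-suc (pr-var 0F)) c)
    L : PRFun 1 (λ Z ρ → level (exponent (lookup ρ 0F)))
    L = pr-suc (pr-* (pr-const 2) c)
    F : PRFun 1 (λ Z ρ → f (level (exponent (lookup ρ 0F))))
    F = pr-primRec f-pr L
    G : PRFun 1 (λ Z ρ → g ⟦ Z ⟧ level (exponent (lookup ρ 0F)))
    G = pr-term g L

  decode-input : ∀ c i → exponent (input c i) ≡ c × rank (input c i) ≡ i
  decode-input c i = exponent≡c , (begin
    (suc (input c i) /2^ exponent (input c i)) / 2
      ≡⟨ cong₂ (λ x e → (x /2^ e) / 2) (suc-pred[2^*suc] c (2 * i)) exponent≡c ⟩
    (2 ^ c * suc (2 * i) /2^ c) / 2
      ≡⟨ cong (_/ 2) (/2^-2^* c (suc (2 * i))) ⟩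
    suc (2 * i) / 2
      ≡⟨ [1+2y]/2≡y i ⟩
    i
      ∎)
    where
    open ≡-Reasoning
    exponent≡c : exponent (input c i) ≡ c
    exponent≡c = trans (cong valuation (suc-pred[2^*suc] c (2 * i))) (valuation-2^*odd c i)

  machine-input : ∀ {Y} c {v} → v < 2 ^ f (level c) → bit v (g ⟦ Y ⟧ level c) ≡ true →
                  machine Y (input c (countBits v (g ⟦ Y ⟧ level c))) ≡ codeOf (f (level c)) v
  machine-input {Y} c {v} v<2^F v∈G =
    trans (cong₂ (λ e r → select (2 ^ f (level e)) (g ⟦ Y ⟧ level e) r (codeOf (f (level e))))
                 (proj₁ (decode-input c i)) (proj₂ (decode-input c i)))
          (select-countBits (codeOf (f (level c))) v<2^F v∈G)
    where
    i : ℕ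
    i = countBits v (g ⟦ Y ⟧ level c)

  -- The measure bound of level 2c + 1 makes the rank of a member short enough to pay for c.
  length-input : ∀ {Y} c {v} → v < 2 ^ f (level c) → bit v (g ⟦ Y ⟧ level c) ≡ true →
                 length (decode (input c (countBits v (g ⟦ Y ⟧ level c)))) + c ≤ f (level c)
  length-input {Y} c {v} v<2^F v∈G = 2^-cancel-≤ (<⇒≤ (begin-strict
    2 ^ (length σ + c)
      ≡⟨ ^-distribˡ-+-* 2 (length σ) c ⟩
    2 ^ length σ * 2 ^ c
      ≤⟨ *-monoˡ-≤ (2 ^ c) (2^length≤suc-code σ) ⟩
    suc (code σ) * 2 ^ c
      ≡⟨ cong (λ k → suc k * 2 ^ c) (code-decode (input c i)) ⟩
    suc (input c i) * 2 ^ c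
      ≡⟨ cong (_* 2 ^ c) (suc-pred[2^*suc] c (2 * i)) ⟩
    2 ^ c * suc (2 * i) * 2 ^ c
      ≤⟨ 2^c*odd*2^c≤ c i ⟩
    suc i * 2 ^ level c
      ≤⟨ *-monoˡ-≤ (2 ^ level c) (countBits<countBits v<2^F v∈G) ⟩
    countBits (2 ^ f (level c)) G * 2 ^ level c
      <⟨ measure-small Y (level c) ⟩
    2 ^ f (level c)
      ∎))
    where
    open ≤-Reasoning
    G i : ℕ
    G = g ⟦ Y ⟧ level c
    i = countBits v G
    σ : Str
    σ = decode (input c i)

  compresses : ∀ {X Y} → (∀ n → inCyl T Y X n) → ∀ c → Σ Str λ σ →
               (length σ + c ≤ f (level c)) × (proj₁ machine-pr ⟦ Y ⟧ code σ ≡ code (X ↾ f (level c)))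
  compresses {X} {Y} cover c = decode (input c i) , length-input c v<2^F (cover (level c)) , (begin
    proj₁ machine-pr ⟦ Y ⟧ code (decode (input c i))
      ≡⟨ proj₂ machine-pr Y (code (decode (input c i)) ∷ []) ⟩
    machine Y (code (decode (input c i)))
      ≡⟨ cong (machine Y) (code-decode (input c i)) ⟩
    machine Y (input c i)
      ≡⟨ machine-input c v<2^F (cover (level c)) ⟩
    codeOf (f (level c)) v
      ≡⟨ code-↾ X (f (level c)) ⟨
    code (X ↾ f (level c))
      ∎)
    where
    open ≡-Reasoning
    v i : ℕ
    v = val (X ↾ f (level c))
    i = countBits v (g ⟦ Y ⟧ level c)
    v<2^F : v < 2 ^ f (level c)
    v<2^F = val-↾<2^ X (f (level c))

covered⇒compressible : ∀ {X Y} → Covered X Y → Compressible X Y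
covered⇒compressible (T , cover) = proj₁ machine-pr , (λ c → f (level c)) , f∘level-pr , compresses cover
  where
  open PRTest T
  open DecompressionMachine T
  f∘level-pr : PrimRec (λ c → f (level c))
  f∘level-pr = PrimRec-∘ f-pr (pr-suc (pr-* (pr-const 2) (pr-var 0F)))

-- Martingales versus Martin-Löf tests

MartingaleSucceeds : Real → Real → Set
MartingaleSucceeds X Y = Σ PROracleMartingale λ D → SucceedsPR D Y X

length-decode-codeOf : ∀ ℓ {p} → p < 2 ^ ℓ → length (decode (codeOf ℓ p)) ≡ ℓ
length-decode-codeOf ℓ {p} p<2^ℓ = begin
  length (decode (codeOf ℓ p))               ≡⟨ lengthOfCode-code (decode (codeOf ℓ p)) ⟨
  lengthOfCode (code (decode (codeOf ℓ p)))  ≡⟨ cong lengthOfCode (code-decode (codeOf ℓ p)) ⟩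
  lengthOfCode (codeOf ℓ p)                  ≡⟨ lengthOfCode-codeOf ℓ p<2^ℓ ⟩
  ℓ                                          ∎
  where open ≡-Reasoning

val-decode-codeOf : ∀ ℓ {p} → p < 2 ^ ℓ → val (decode (codeOf ℓ p)) ≡ p
val-decode-codeOf ℓ {p} p<2^ℓ = begin
  val (decode (codeOf ℓ p))                  ≡⟨ valueOfCode-code (decode (codeOf ℓ p)) ⟨
  valueOfCode (code (decode (codeOf ℓ p)))   ≡⟨ cong valueOfCode (code-decode (codeOf ℓ p)) ⟩
  valueOfCode (codeOf ℓ p)                   ≡⟨ valueOfCode-codeOf ℓ p<2^ℓ ⟩
  p                                          ∎
  where open ≡-Reasoning

module MartingaleValues (D : PROracleMartingale) where

  open PROracleMartingale D

  value : Real → ℕ → ℚ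
  value Z N = frac (num ⟦ Z ⟧ N) (den ⟦ Z ⟧ N)

  d≡value : ∀ Z σ → d Z σ ≡ value Z (code σ)
  d≡value Z σ = sym (frac-def (num ⟦ Z ⟧ code σ) (den ⟦ Z ⟧ code σ))

  d-pair : ∀ Z σ → d Z (σ ++ false ∷ []) ℚ.+ d Z (σ ++ true ∷ []) ≡ d Z σ ℚ.+ d Z σ
  d-pair Z σ = trans (sym (twice-half _)) (cong (λ t → t ℚ.+ t) (sym (d-fair Z σ)))
    where
    open ℚSolver.+-*-Solver
    twice-half : ∀ w → ½ ℚ.* w ℚ.+ ½ ℚ.* w ≡ w
    twice-half = solve 1 (λ w → con ½ :* w :+ con ½ :* w := w) refl

  value-pair : ∀ Z ℓ {p} → p < 2 ^ ℓ →
               value Z (codeOf (suc ℓ) p) ℚ.+ value Z (codeOf (suc ℓ) (2 ^ ℓ + p)) ≡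
               value Z (codeOf ℓ p) ℚ.+ value Z (codeOf ℓ p)
  value-pair Z ℓ {p} p<2^ℓ = begin
    value Z (codeOf (suc ℓ) p) ℚ.+ value Z (codeOf (suc ℓ) (2 ^ ℓ + p))
      ≡⟨ cong₂ (λ a b → value Z a ℚ.+ value Z b) (child false) (child true) ⟨
    value Z (code (σ ++ false ∷ [])) ℚ.+ value Z (code (σ ++ true ∷ []))
      ≡⟨ cong₂ ℚ._+_ (d≡value Z (σ ++ false ∷ [])) (d≡value Z (σ ++ true ∷ [])) ⟨
    d Z (σ ++ false ∷ []) ℚ.+ d Z (σ ++ true ∷ [])
      ≡⟨ d-pair Z σ ⟩
    d Z σ ℚ.+ d Z σ
      ≡⟨ cong (λ t → t ℚ.+ t) (trans (d≡value Z σ) (cong (value Z) (code-decode (codeOf ℓ p)))) ⟩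
    value Z (codeOf ℓ p) ℚ.+ value Z (codeOf ℓ p)
      ∎
    where
    open ≡-Reasoning
    σ : Str
    σ = decode (codeOf ℓ p)
    child : ∀ b → code (σ ++ b ∷ []) ≡ codeOf (suc ℓ) (if b then 2 ^ ℓ + p else p)
    child b = trans (code≡codeOf (σ ++ b ∷ [])) (cong₂ codeOf
      (trans (length-∷ʳ σ b) (cong suc (length-decode-codeOf ℓ p<2^ℓ)))
      (trans (val-∷ʳ-if σ b) (cong₂ (λ ℓ′ v → if b then 2 ^ ℓ′ + v else v)
                                     (length-decode-codeOf ℓ p<2^ℓ) (val-decode-codeOf ℓ p<2^ℓ))))

  kolmogorov : ∀ Z ℓ → ∑ℚ< (2 ^ ℓ) (λ p → value Z (codeOf ℓ p)) ≡ ι (2 ^ ℓ)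
  kolmogorov Z zero    =
    trans (ℚP.+-identityˡ _) (trans (sym (d≡value Z [])) (trans (d-empty Z) (sym frac-1-0)))
  kolmogorov Z (suc ℓ) = begin
    ∑ℚ< (2 ^ suc ℓ) (λ p → value Z (codeOf (suc ℓ) p))
      ≡⟨ cong (λ K → ∑ℚ< K (λ p → value Z (codeOf (suc ℓ) p))) (2^suc≡2^+2^ ℓ) ⟩
    ∑ℚ< (2 ^ ℓ + 2 ^ ℓ) (λ p → value Z (codeOf (suc ℓ) p))
      ≡⟨ ∑ℚ<-split (2 ^ ℓ) (2 ^ ℓ) _ ⟩
    ∑ℚ< (2 ^ ℓ) (λ p → value Z (codeOf (suc ℓ) p)) ℚ.+
    ∑ℚ< (2 ^ ℓ) (λ p → value Z (codeOf (suc ℓ) (2 ^ ℓ + p)))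
      ≡⟨ ∑ℚ<-distrib (2 ^ ℓ) _ _ ⟨
    ∑ℚ< (2 ^ ℓ) (λ p → value Z (codeOf (suc ℓ) p) ℚ.+ value Z (codeOf (suc ℓ) (2 ^ ℓ + p)))
      ≡⟨ ∑ℚ<-cong (2 ^ ℓ) (λ p p<2^ℓ → value-pair Z ℓ p<2^ℓ) ⟩
    ∑ℚ< (2 ^ ℓ) (λ p → value Z (codeOf ℓ p) ℚ.+ value Z (codeOf ℓ p))
      ≡⟨ ∑ℚ<-distrib (2 ^ ℓ) _ _ ⟩
    ∑ℚ< (2 ^ ℓ) (λ p → value Z (codeOf ℓ p)) ℚ.+ ∑ℚ< (2 ^ ℓ) (λ p → value Z (codeOf ℓ p))
      ≡⟨ cong (λ t → t ℚ.+ t) (kolmogorov Z ℓ) ⟩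
    ι (2 ^ ℓ) ℚ.+ ι (2 ^ ℓ)
      ≡⟨ trans (ι-+ (2 ^ ℓ) (2 ^ ℓ)) (cong ι (sym (2^suc≡2^+2^ ℓ))) ⟩
    ι (2 ^ suc ℓ)
      ∎
    where open ≡-Reasoning

module SuccessTest (D : PROracleMartingale) (f : ℕ → ℕ) (f-pr : PrimRec f) where

  open PROracleMartingale D
  open MartingaleValues D

  F : ℕ → ℕ
  F n = f (suc n)

  member : Real → ℕ → ℕ → Bool
  member Z n p = 2 ^ suc n * suc (den ⟦ Z ⟧ codeOf (F n) p) ≤ᵇ num ⟦ Z ⟧ codeOf (F n) p

  member-pr : ∀ {m N P} → PRFun m N → PRFun m P → PRFun m (λ Z ρ → indicator (member Z (N Z ρ) (P Z ρ)))
  member-pr {m} {N} {P} n p =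
    pr-≤ᵇ (pr-* (pr-2^ (pr-suc n)) (pr-suc (pr-term den code-pr))) (pr-term num code-pr)
    where
    code-pr : PRFun m (λ Z ρ → codeOf (F (N Z ρ)) (P Z ρ))
    code-pr = pr-codeOf (pr-primRec f-pr (pr-suc n)) p

  member≤value : ∀ Z n p → ι (2 ^ suc n * indicator (member Z n p)) ℚ.≤ value Z (codeOf (F n) p)
  member≤value Z n p with member Z n p in m
  ... | true  = subst (ℚ._≤ value Z (codeOf (F n) p)) (cong ι (sym (*-identityʳ (2 ^ suc n))))
                      (*suc≤⇒ι≤frac (≤ᵇ⇒≤ _ _ (subst T (sym m) _)))
  ... | false = subst (ℚ._≤ value Z (codeOf (F n) p)) (trans (sym frac-0-0) (cong ι (sym (*-zeroʳ (2 ^ suc n)))))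
                      (0≤frac _ _)

  sparse : ∀ Z n → ∑< (2 ^ F n) (λ p → indicator (member Z n p)) * 2 ^ n < 2 ^ F n
  sparse Z n = m*2≤n⇒m<n (subst (_≤ 2 ^ F n) reassoc (ι-cancel-≤ bound)) (m^n>0 2 (F n))
    where
    count : ℕ
    count = ∑< (2 ^ F n) (λ p → indicator (member Z n p))
    reassoc : count * 2 ^ suc n ≡ count * 2 ^ n * 2
    reassoc = trans (cong (count *_) (*-comm 2 (2 ^ n))) (sym (*-assoc count (2 ^ n) 2))
    bound : ι (count * 2 ^ suc n) ℚ.≤ ι (2 ^ F n)
    bound = begin
      ι (count * 2 ^ suc n)
        ≡⟨ cong ι (trans (*-comm count _) (sym (∑<-*ˡ (2 ^ F n) (2 ^ suc n) _))) ⟩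
      ι (∑< (2 ^ F n) (λ p → 2 ^ suc n * indicator (member Z n p)))
        ≡⟨ ι-∑< (2 ^ F n) _ ⟨
      ∑ℚ< (2 ^ F n) (λ p → ι (2 ^ suc n * indicator (member Z n p)))
        ≤⟨ ∑ℚ<-mono-≤ (2 ^ F n) (λ p _ → member≤value Z n p) ⟩
      ∑ℚ< (2 ^ F n) (λ p → value Z (codeOf (F n) p))
        ≡⟨ kolmogorov Z (F n) ⟩
      ι (2 ^ F n)
        ∎
      where open ℚP.≤-Reasoning

  open SetTest F (PrimRec-∘ f-pr (pr-suc (pr-var 0F))) member member-pr sparse public

  large⇒member : ∀ {X Y} n → ι (2 ^ suc n) ℚ.≤ d Y (X ↾ F n) → T (member Y n (val (X ↾ F n)))
  large⇒member {X} {Y} n large = ≤⇒≤ᵇ (ι≤frac⇒*suc≤ (subst (ι (2 ^ suc n) ℚ.≤_) d≡value-at-code large))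
    where
    d≡value-at-code : d Y (X ↾ F n) ≡ value Y (codeOf (F n) (val (X ↾ F n)))
    d≡value-at-code = trans (d≡value Y (X ↾ F n)) (cong (value Y) (code-↾ X (F n)))

succeeds⇒covered : ∀ {X Y} → MartingaleSucceeds X Y → Covered X Y
succeeds⇒covered {X} {Y} (D , f , f-pr , succeeds) =
  test , λ n → test-covers (large⇒member n (subst (ℚ._≤ PROracleMartingale.d D Y (X ↾ f (suc n)))
                                                  (sym (frac-def (2 ^ suc n) 0)) (succeeds (suc n))))
  where open SuccessTest D f f-pr

module CoverMartingale (T : PRTest) where

  open PRTest T

  level : ℕ → ℕ
  level k = suc (3 * k)

  F : ℕ → ℕ
  F k = f (level k)

  G : Real → ℕ → ℕ
  G Z k = g ⟦ Z ⟧ level k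

  weight : ℕ → ℕ
  weight k = 2 ^ k * 2 ^ suc k

  -- p %2^ j is the value of the first j bits of the string of length F k and value p.
  extensions : Real → ℕ → ℕ → ℕ → ℕ
  extensions Z k j u = ∑< (2 ^ F k) (λ p → indicator (bit p (G Z k)) * indicator (p %2^ j ≡ᵇ u))

  extending : Real → ℕ → ℕ → ℕ → ℕ
  extending Z k ℓ v = extensions Z k (ℓ ⊓ F k) (v %2^ (ℓ ⊓ F k))

  -- The conditional measure of [G_k] in the cylinder of the string of length ℓ and value v.
  density : Real → ℕ → ℕ → ℕ → ℚ
  density Z k ℓ v = ι (extending Z k ℓ v) ℚ.* ½^ (F k ∸ ℓ)

  -- 1 - weight k * density Z k k v, with the subtraction done in ℕ; it never truncates.
  offset : Real → ℕ → ℕ → ℚ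
  offset Z k v = frac (2 ^ (F k ∸ k) ∸ weight k * extending Z k k v) (pred (2 ^ (F k ∸ k)))

  component : Real → ℕ → ℕ → ℕ → ℚ
  component Z k ℓ v = offset Z k v ℚ.+ ι (weight k) ℚ.* density Z k ℓ v

  term : Real → ℕ → ℕ → ℕ → ℚ
  term Z k ℓ v = ½^ (suc k) ℚ.* component Z k ℓ v

  -- component k is a martingale from length k on, where it equals 1 (offset+weight*density≡1);
  -- ½^ ℓ stands for the components k ≥ ℓ, which are still 1.
  martingale : Real → ℕ → ℕ → ℚ
  martingale Z ℓ v = ½^ ℓ ℚ.+ ∑ℚ< ℓ (λ k → term Z k ℓ v)

  extensions≤countBits : ∀ Z k j u → extensions Z k j u ≤ countBits (2 ^ F k) (G Z k)
  extensions≤countBits Z k j u = begin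
    extensions Z k j u
      ≤⟨ ∑<-mono-≤ (2 ^ F k) (λ p _ → m*indicator≤m (indicator (bit p (G Z k))) (p %2^ j ≡ᵇ u)) ⟩
    ∑< (2 ^ F k) (λ p → indicator (bit p (G Z k)))
      ≡⟨ countBits≡∑< (2 ^ F k) (G Z k) ⟨
    countBits (2 ^ F k) (G Z k)
      ∎
    where
    open ≤-Reasoning
    m*indicator≤m : ∀ m b → m * indicator b ≤ m
    m*indicator≤m m b = ≤-trans (*-monoʳ-≤ m (indicator≤1 b)) (≤-reflexive (*-identityʳ m))

  weight*extensions≤ : ∀ Z k j u → weight k * extensions Z k j u ≤ 2 ^ (F k ∸ k)
  weight*extensions≤ Z k j u = *2^<2^⇒≤2^∸ k (F k) (begin-strict
    weight k * extensions Z k j u * 2 ^ k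
      ≤⟨ *-monoˡ-≤ (2 ^ k) (*-monoʳ-≤ (weight k) (extensions≤countBits Z k j u)) ⟩
    weight k * count * 2 ^ k
      ≡⟨ reorder (weight k) count (2 ^ k) ⟩
    count * (weight k * 2 ^ k)
      ≡⟨ cong (count *_) weight*2^k ⟩
    count * 2 ^ level k
      <⟨ measure-small Z (level k) ⟩
    2 ^ F k
      ∎)
    where
    open ≤-Reasoning
    count : ℕ
    count = countBits (2 ^ F k) (G Z k)
    reorder : ∀ a b c → a * b * c ≡ b * (a * c)
    reorder = solve-∀
    exponents : ∀ k → k + suc k + k ≡ suc (3 * k)
    exponents = solve-∀
    weight*2^k : weight k * 2 ^ k ≡ 2 ^ level k
    weight*2^k = begin-equality
      2 ^ k * 2 ^ suc k * 2 ^ k   ≡⟨ cong (_* 2 ^ k) (^-distribˡ-+-* 2 k (suc k)) ⟨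
      2 ^ (k + suc k) * 2 ^ k     ≡⟨ ^-distribˡ-+-* 2 (k + suc k) k ⟨
      2 ^ (k + suc k + k)         ≡⟨ cong (2 ^_) (exponents k) ⟩
      2 ^ level k                 ∎

  offset+weight*density≡1 : ∀ Z k v → offset Z k v ℚ.+ ι (weight k) ℚ.* density Z k k v ≡ 1ℚ
  offset+weight*density≡1 Z k v = begin
    offset Z k v ℚ.+ ι (weight k) ℚ.* (ι E ℚ.* ½^ y)
      ≡⟨ cong (offset Z k v ℚ.+_) (trans (sym (ℚP.*-assoc (ι (weight k)) (ι E) (½^ y)))
                                         (trans (cong (ℚ._* ½^ y) (ι-* (weight k) E)) (ι*½^ (weight k * E) y))) ⟩
    frac (2 ^ y ∸ weight k * E) b ℚ.+ frac (weight k * E) b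
      ≡⟨ frac-complement (trans (m∸n+n≡m (weight*extensions≤ Z k (k ⊓ F k) (v %2^ (k ⊓ F k))))
                                (sym (suc-pred[2^ℓ] y))) ⟩
    1ℚ
      ∎
    where
    open ≡-Reasoning
    y b E : ℕ
    y = F k ∸ k
    b = pred (2 ^ y)
    E = extending Z k k v

  offset-shift : ∀ Z k {ℓ} v → k ≤ ℓ → offset Z k (2 ^ ℓ + v) ≡ offset Z k v
  offset-shift Z k v k≤ℓ =
    cong (λ u → frac (2 ^ (F k ∸ k) ∸ weight k * extensions Z k (k ⊓ F k) u) (pred (2 ^ (F k ∸ k))))
         (%2^-+2^ v (≤-trans (m⊓n≤m k (F k)) k≤ℓ))

  extensions-partition : ∀ Z k ℓ {u} → u < 2 ^ ℓ →
    extensions Z k (suc ℓ) u + extensions Z k (suc ℓ) (2 ^ ℓ + u) ≡ extensions Z k ℓ u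
  extensions-partition Z k ℓ {u} u<2^ℓ =
    trans (sym (∑<-distrib (2 ^ F k) _ _)) (∑<-cong (2 ^ F k) (λ p _ → pointwise p))
    where
    pointwise : ∀ p → indicator (bit p (G Z k)) * indicator (p %2^ suc ℓ ≡ᵇ u) +
                      indicator (bit p (G Z k)) * indicator (p %2^ suc ℓ ≡ᵇ 2 ^ ℓ + u) ≡
                      indicator (bit p (G Z k)) * indicator (p %2^ ℓ ≡ᵇ u)
    pointwise p = begin
      b * indicator (r ≡ᵇ u) + b * indicator (r ≡ᵇ 2 ^ ℓ + u)
        ≡⟨ *-distribˡ-+ b _ _ ⟨
      b * (indicator (r ≡ᵇ u) + indicator (r ≡ᵇ 2 ^ ℓ + u))
        ≡⟨ cong (b *_) (indicator-%2^-split ℓ (m%n<n p (2 ^ suc ℓ) {{m^n≢0 2 (suc ℓ)}}) u<2^ℓ) ⟩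
      b * indicator (r %2^ ℓ ≡ᵇ u)
        ≡⟨ cong (λ x → b * indicator (x ≡ᵇ u)) r%2^ℓ ⟩
      b * indicator (p %2^ ℓ ≡ᵇ u)
        ∎
      where
      open ≡-Reasoning
      b r : ℕ
      b = indicator (bit p (G Z k))
      r = p %2^ suc ℓ
      r%2^ℓ : r %2^ ℓ ≡ p %2^ ℓ
      r%2^ℓ = m∣n⇒o%n%m≡o%m (2 ^ ℓ) (2 ^ suc ℓ) p {{m^n≢0 2 ℓ}} {{m^n≢0 2 (suc ℓ)}} (2^∣2^ (n≤1+n ℓ))

  density-below : ∀ Z k {ℓ v} → ℓ ≤ F k → v < 2 ^ ℓ →
                  density Z k ℓ v ≡ ι (extensions Z k ℓ v) ℚ.* ½^ (F k ∸ ℓ)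
  density-below Z k {ℓ} {v} ℓ≤F v<2^ℓ = trans
    (cong (λ j → ι (extensions Z k j (v %2^ j)) ℚ.* ½^ (F k ∸ ℓ)) (m≤n⇒m⊓n≡m ℓ≤F))
    (cong (λ u → ι (extensions Z k ℓ u) ℚ.* ½^ (F k ∸ ℓ)) (m<n⇒m%n≡m {{m^n≢0 2 ℓ}} v<2^ℓ))

  density-above : ∀ Z k {ℓ} v → F k ≤ ℓ → density Z k ℓ v ≡ ι (extensions Z k (F k) (v %2^ F k)) ℚ.* ½^ 0
  density-above Z k {ℓ} v F≤ℓ =
    cong₂ (λ j y → ι (extensions Z k j (v %2^ j)) ℚ.* ½^ y) (m≥n⇒m⊓n≡n F≤ℓ) (m≤n⇒m∸n≡0 F≤ℓ)

  density-pair : ∀ Z k ℓ {v} → v < 2 ^ ℓ →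
    density Z k (suc ℓ) v ℚ.+ density Z k (suc ℓ) (2 ^ ℓ + v) ≡ density Z k ℓ v ℚ.+ density Z k ℓ v
  density-pair Z k ℓ {v} v<2^ℓ with suc ℓ ≤? F k
  ... | yes ℓ<F = begin
    density Z k (suc ℓ) v ℚ.+ density Z k (suc ℓ) (2 ^ ℓ + v)
      ≡⟨ cong₂ ℚ._+_ (density-below Z k ℓ<F v<2^[1+ℓ]) (density-below Z k ℓ<F 2^ℓ+v<2^[1+ℓ]) ⟩
    ι E₁ ℚ.* ½^ y ℚ.+ ι E₂ ℚ.* ½^ y
      ≡⟨ ℚP.*-distribʳ-+ (½^ y) (ι E₁) (ι E₂) ⟨
    (ι E₁ ℚ.+ ι E₂) ℚ.* ½^ y
      ≡⟨ cong (ℚ._* ½^ y) (trans (ι-+ E₁ E₂) (cong ι (extensions-partition Z k ℓ v<2^ℓ))) ⟩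
    ι E ℚ.* ½^ y
      ≡⟨ cong (ι E ℚ.*_) (½^-split y) ⟩
    ι E ℚ.* (½^ (suc y) ℚ.+ ½^ (suc y))
      ≡⟨ ℚP.*-distribˡ-+ (ι E) _ _ ⟩
    ι E ℚ.* ½^ (suc y) ℚ.+ ι E ℚ.* ½^ (suc y)
      ≡⟨ cong (λ t → t ℚ.+ t) (trans (cong (λ z → ι E ℚ.* ½^ z) (sym (+-∸-assoc 1 ℓ<F)))
                                      (sym (density-below Z k (<⇒≤ ℓ<F) v<2^ℓ))) ⟩
    density Z k ℓ v ℚ.+ density Z k ℓ v
      ∎
    where
    open ≡-Reasoning
    y E₁ E₂ E : ℕ
    y = F k ∸ suc ℓ
    E₁ = extensions Z k (suc ℓ) v
    E₂ = extensions Z k (suc ℓ) (2 ^ ℓ + v)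
    E = extensions Z k ℓ v
    v<2^[1+ℓ] : v < 2 ^ suc ℓ
    v<2^[1+ℓ] = <-≤-trans v<2^ℓ (^-monoʳ-≤ 2 (n≤1+n ℓ))
    2^ℓ+v<2^[1+ℓ] : 2 ^ ℓ + v < 2 ^ suc ℓ
    2^ℓ+v<2^[1+ℓ] = subst (2 ^ ℓ + v <_) (sym (2^suc≡2^+2^ ℓ)) (+-monoʳ-< (2 ^ ℓ) v<2^ℓ)
  ... | no  ℓ≮F = begin
    density Z k (suc ℓ) v ℚ.+ density Z k (suc ℓ) (2 ^ ℓ + v)
      ≡⟨ cong₂ ℚ._+_ (density-above Z k v F≤1+ℓ) (density-above Z k (2 ^ ℓ + v) F≤1+ℓ) ⟩
    top v ℚ.+ top (2 ^ ℓ + v)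
      ≡⟨ cong (λ u → top v ℚ.+ ι (extensions Z k (F k) u) ℚ.* ½^ 0) (%2^-+2^ v F≤ℓ) ⟩
    top v ℚ.+ top v
      ≡⟨ cong₂ ℚ._+_ (density-above Z k v F≤ℓ) (density-above Z k v F≤ℓ) ⟨
    density Z k ℓ v ℚ.+ density Z k ℓ v
      ∎
    where
    open ≡-Reasoning
    top : ℕ → ℚ
    top u = ι (extensions Z k (F k) (u %2^ F k)) ℚ.* ½^ 0
    F≤ℓ : F k ≤ ℓ
    F≤ℓ = ≤-pred (≰⇒> ℓ≮F)
    F≤1+ℓ : F k ≤ suc ℓ
    F≤1+ℓ = m≤n⇒m≤1+n F≤ℓ

  component-pair : ∀ Z {k ℓ v} → k ≤ ℓ → v < 2 ^ ℓ →
    component Z k (suc ℓ) v ℚ.+ component Z k (suc ℓ) (2 ^ ℓ + v) ≡ component Z k ℓ v ℚ.+ component Z k ℓ v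
  component-pair Z {k} {ℓ} {v} k≤ℓ v<2^ℓ = begin
    (a ℚ.+ c ℚ.* w₁) ℚ.+ (offset Z k (2 ^ ℓ + v) ℚ.+ c ℚ.* w₂)
      ≡⟨ cong (λ a′ → (a ℚ.+ c ℚ.* w₁) ℚ.+ (a′ ℚ.+ c ℚ.* w₂)) (offset-shift Z k v k≤ℓ) ⟩
    (a ℚ.+ c ℚ.* w₁) ℚ.+ (a ℚ.+ c ℚ.* w₂)
      ≡⟨ regroup a c w₁ w₂ ⟩
    (a ℚ.+ a) ℚ.+ c ℚ.* (w₁ ℚ.+ w₂)
      ≡⟨ cong (λ w → (a ℚ.+ a) ℚ.+ c ℚ.* w) (density-pair Z k ℓ v<2^ℓ) ⟩
    (a ℚ.+ a) ℚ.+ c ℚ.* (w ℚ.+ w)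
      ≡⟨ regroup a c w w ⟨
    (a ℚ.+ c ℚ.* w) ℚ.+ (a ℚ.+ c ℚ.* w)
      ∎
    where
    open ≡-Reasoning
    open ℚSolver.+-*-Solver
    a c w₁ w₂ w : ℚ
    a = offset Z k v
    c = ι (weight k)
    w₁ = density Z k (suc ℓ) v
    w₂ = density Z k (suc ℓ) (2 ^ ℓ + v)
    w = density Z k ℓ v
    regroup : ∀ a c x y → (a ℚ.+ c ℚ.* x) ℚ.+ (a ℚ.+ c ℚ.* y) ≡ (a ℚ.+ a) ℚ.+ c ℚ.* (x ℚ.+ y)
    regroup = solve 4 (λ a c x y → (a :+ c :* x) :+ (a :+ c :* y) := (a :+ a) :+ c :* (x :+ y)) refl

  term-pair : ∀ Z {k ℓ v} → k ≤ ℓ → v < 2 ^ ℓ →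
              term Z k (suc ℓ) v ℚ.+ term Z k (suc ℓ) (2 ^ ℓ + v) ≡ term Z k ℓ v ℚ.+ term Z k ℓ v
  term-pair Z {k} k≤ℓ v<2^ℓ = trans (sym (ℚP.*-distribˡ-+ (½^ (suc k)) _ _))
    (trans (cong (½^ (suc k) ℚ.*_) (component-pair Z k≤ℓ v<2^ℓ)) (ℚP.*-distribˡ-+ (½^ (suc k)) _ _))

  term-new : ∀ Z ℓ {v} → v < 2 ^ ℓ → term Z ℓ (suc ℓ) v ℚ.+ term Z ℓ (suc ℓ) (2 ^ ℓ + v) ≡ ½^ ℓ
  term-new Z ℓ {v} v<2^ℓ = begin
    term Z ℓ (suc ℓ) v ℚ.+ term Z ℓ (suc ℓ) (2 ^ ℓ + v)
      ≡⟨ term-pair Z ≤-refl v<2^ℓ ⟩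
    ½^ (suc ℓ) ℚ.* component Z ℓ ℓ v ℚ.+ ½^ (suc ℓ) ℚ.* component Z ℓ ℓ v
      ≡⟨ cong (λ x → ½^ (suc ℓ) ℚ.* x ℚ.+ ½^ (suc ℓ) ℚ.* x) (offset+weight*density≡1 Z ℓ v) ⟩
    ½^ (suc ℓ) ℚ.* 1ℚ ℚ.+ ½^ (suc ℓ) ℚ.* 1ℚ
      ≡⟨ cong (λ x → x ℚ.+ x) (ℚP.*-identityʳ (½^ (suc ℓ))) ⟩
    ½^ (suc ℓ) ℚ.+ ½^ (suc ℓ)
      ≡⟨ ½^-split ℓ ⟨
    ½^ ℓ
      ∎
    where open ≡-Reasoning

  martingale-pair : ∀ Z ℓ {v} → v < 2 ^ ℓ →
    martingale Z (suc ℓ) v ℚ.+ martingale Z (suc ℓ) (2 ^ ℓ + v) ≡ martingale Z ℓ v ℚ.+ martingale Z ℓ v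
  martingale-pair Z ℓ {v} v<2^ℓ = begin
    (h ℚ.+ (∑ℚ< ℓ t₁ ℚ.+ t₁ ℓ)) ℚ.+ (h ℚ.+ (∑ℚ< ℓ t₂ ℚ.+ t₂ ℓ))
      ≡⟨ regroup h (∑ℚ< ℓ t₁) (∑ℚ< ℓ t₂) (t₁ ℓ) (t₂ ℓ) ⟩
    (h ℚ.+ h) ℚ.+ ((∑ℚ< ℓ t₁ ℚ.+ ∑ℚ< ℓ t₂) ℚ.+ (t₁ ℓ ℚ.+ t₂ ℓ))
      ≡⟨ cong₂ (λ x y → x ℚ.+ (y ℚ.+ (t₁ ℓ ℚ.+ t₂ ℓ))) (sym (½^-split ℓ)) old-terms ⟩
    ½^ ℓ ℚ.+ ((S ℚ.+ S) ℚ.+ (t₁ ℓ ℚ.+ t₂ ℓ))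
      ≡⟨ cong (λ x → ½^ ℓ ℚ.+ ((S ℚ.+ S) ℚ.+ x)) (term-new Z ℓ v<2^ℓ) ⟩
    ½^ ℓ ℚ.+ ((S ℚ.+ S) ℚ.+ ½^ ℓ)
      ≡⟨ regroup′ (½^ ℓ) S ⟩
    (½^ ℓ ℚ.+ S) ℚ.+ (½^ ℓ ℚ.+ S)
      ∎
    where
    open ≡-Reasoning
    open ℚSolver.+-*-Solver
    h : ℚ
    h = ½^ (suc ℓ)
    t₁ t₂ t : ℕ → ℚ
    t₁ k = term Z k (suc ℓ) v
    t₂ k = term Z k (suc ℓ) (2 ^ ℓ + v)
    t  k = term Z k ℓ v
    S : ℚ
    S = ∑ℚ< ℓ t
    old-terms : ∑ℚ< ℓ t₁ ℚ.+ ∑ℚ< ℓ t₂ ≡ S ℚ.+ S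
    old-terms = begin
      ∑ℚ< ℓ t₁ ℚ.+ ∑ℚ< ℓ t₂              ≡⟨ ∑ℚ<-distrib ℓ t₁ t₂ ⟨
      ∑ℚ< ℓ (λ k → t₁ k ℚ.+ t₂ k)        ≡⟨ ∑ℚ<-cong ℓ (λ k k<ℓ → term-pair Z (<⇒≤ k<ℓ) v<2^ℓ) ⟩
      ∑ℚ< ℓ (λ k → t k ℚ.+ t k)          ≡⟨ ∑ℚ<-distrib ℓ t t ⟩
      S ℚ.+ S                            ∎
    regroup : ∀ h a b x y →
              (h ℚ.+ (a ℚ.+ x)) ℚ.+ (h ℚ.+ (b ℚ.+ y)) ≡ (h ℚ.+ h) ℚ.+ ((a ℚ.+ b) ℚ.+ (x ℚ.+ y))
    regroup = solve 5 (λ h a b x y →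
                (h :+ (a :+ x)) :+ (h :+ (b :+ y)) := (h :+ h) :+ ((a :+ b) :+ (x :+ y))) refl
    regroup′ : ∀ p s → p ℚ.+ ((s ℚ.+ s) ℚ.+ p) ≡ (p ℚ.+ s) ℚ.+ (p ℚ.+ s)
    regroup′ = solve 2 (λ p s → p :+ ((s :+ s) :+ p) := (p :+ s) :+ (p :+ s)) refl

  martingale-empty : ∀ Z → martingale Z 0 0 ≡ 1ℚ
  martingale-empty Z = trans (ℚP.+-identityʳ (½^ 0)) ½^-zero

  module _ {n : ℕ} where

    pr-F : ∀ {K} → PRFun n K → PRFun n (λ Z ρ → F (K Z ρ))
    pr-F k = pr-primRec f-pr (pr-suc (pr-* (pr-const 3) k))

    pr-extensions : ∀ {K J U} → PRFun n K → PRFun n J → PRFun n U →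
                    PRFun n (λ Z ρ → extensions Z (K Z ρ) (J Z ρ) (U Z ρ))
    pr-extensions k j u = pr-∑< (pr-2^ (pr-F k))
      (pr-* (pr-bit (pr-var 0F) (pr-weaken (pr-term g (pr-suc (pr-* (pr-const 3) k)))))
            (pr-≡ᵇ (pr-%2^ (pr-var 0F) (pr-weaken j)) (pr-weaken u)))

    prℚ-density : ∀ {K L V} → PRFun n K → PRFun n L → PRFun n V →
                  PRℚ n (λ Z ρ → density Z (K Z ρ) (L Z ρ) (V Z ρ))
    prℚ-density {K} {L} k l v = prℚ-* (prℚ-ι (pr-extensions k j (pr-%2^ v j))) (prℚ-½^ (pr-∸ (pr-F k) l))
      where
      j : PRFun n (λ Z ρ → L Z ρ ⊓ F (K Z ρ))
      j = pr-⊓ l (pr-F k)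

    prℚ-component : ∀ {K L V} → PRFun n K → PRFun n L → PRFun n V →
                    PRℚ n (λ Z ρ → component Z (K Z ρ) (L Z ρ) (V Z ρ))
    prℚ-component {K} k l v =
      prℚ-+ (prℚ-frac (pr-∸ (pr-2^ y) (pr-* weight-pr (pr-extensions k j (pr-%2^ v j)))) (pr-pred (pr-2^ y)))
            (prℚ-* (prℚ-ι weight-pr) (prℚ-density k l v))
      where
      j : PRFun n (λ Z ρ → K Z ρ ⊓ F (K Z ρ))
      j = pr-⊓ k (pr-F k)
      y : PRFun n (λ Z ρ → F (K Z ρ) ∸ K Z ρ)
      y = pr-∸ (pr-F k) k
      weight-pr : PRFun n (λ Z ρ → weight (K Z ρ))
      weight-pr = pr-* (pr-2^ k) (pr-2^ (pr-suc k))

  -- Opaque: unfolding the generated numerator and denominator exhausts memory.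
  opaque
    prℚ-martingale : PRℚ 1 (λ Z ρ → martingale Z (lengthOfCode (lookup ρ 0F)) (valueOfCode (lookup ρ 0F)))
    prℚ-martingale = prℚ-+ (prℚ-½^ ℓ)
      (prℚ-∑< ℓ (prℚ-* (prℚ-½^ (pr-suc (pr-var 0F))) (prℚ-component (pr-var 0F) (pr-weaken ℓ) (pr-weaken v))))
      where
      ℓ : PRFun 1 (λ Z ρ → lengthOfCode (lookup ρ 0F))
      ℓ = pr-lengthOfCode (pr-var 0F)
      v : PRFun 1 (λ Z ρ → valueOfCode (lookup ρ 0F))
      v = pr-valueOfCode (pr-var 0F)

  private
    module M = PRℚ prℚ-martingale

  numTerm denTerm : PR 1
  numTerm = proj₁ M.num-pr
  denTerm = proj₁ M.den-pr

  value : Real → ℕ → ℚ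
  value Z N = ℤ.+ (numTerm ⟦ Z ⟧ N) ℚ./ suc (denTerm ⟦ Z ⟧ N)

  value≡martingale : ∀ Z σ → value Z (code σ) ≡ martingale Z (length σ) (val σ)
  value≡martingale Z σ = begin
    value Z (code σ)
      ≡⟨ frac-def _ _ ⟨
    frac (numTerm ⟦ Z ⟧ code σ) (denTerm ⟦ Z ⟧ code σ)
      ≡⟨ cong₂ frac (proj₂ M.num-pr Z ρ) (proj₂ M.den-pr Z ρ) ⟩
    frac (M.num Z ρ) (M.den Z ρ)
      ≡⟨ M.frac≡ Z ρ ⟩
    martingale Z (lengthOfCode (code σ)) (valueOfCode (code σ))
      ≡⟨ cong₂ (martingale Z) (lengthOfCode-code σ) (valueOfCode-code σ) ⟩
    martingale Z (length σ) (val σ)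
      ∎
    where
    open ≡-Reasoning
    ρ : Vec ℕ 1
    ρ = code σ ∷ []

  coverMartingale : PROracleMartingale
  coverMartingale = record
    { num     = numTerm
    ; den     = denTerm
    ; d-empty = λ Z → trans (value≡martingale Z []) (martingale-empty Z)
    ; d-fair  = λ Z σ → begin
        value Z (code σ)
           ≡⟨ value≡martingale Z σ ⟩
        martingale Z (length σ) (val σ)
           ≡⟨ halve {a = martingale Z (suc (length σ)) (val σ)}
                    {b = martingale Z (suc (length σ)) (2 ^ length σ + val σ)}
                    (martingale-pair Z (length σ) (val<2^length σ)) ⟩
        ½ ℚ.* (martingale Z (suc (length σ)) (val σ) ℚ.+ martingale Z (suc (length σ)) (2 ^ length σ + val σ))
           ≡⟨ cong (λ x → ½ ℚ.* x) (cong₂ ℚ._+_ (child Z σ false) (child Z σ true)) ⟨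
        ½ ℚ.* (value Z (code (σ ++ false ∷ [])) ℚ.+ value Z (code (σ ++ true ∷ [])))
           ∎
    }
    where
    open ≡-Reasoning
    halve : ∀ {x a b} → a ℚ.+ b ≡ x ℚ.+ x → x ≡ ½ ℚ.* (a ℚ.+ b)
    halve {x} {a} {b} a+b≡x+x = trans (sym (half-double x)) (cong (½ ℚ.*_) (sym a+b≡x+x))
      where
      open ℚSolver.+-*-Solver
      half-double : ∀ x → ½ ℚ.* (x ℚ.+ x) ≡ x
      half-double = solve 1 (λ x → con ½ :* (x :+ x) := x) refl
    child : ∀ Z σ b → value Z (code (σ ++ b ∷ [])) ≡
                      martingale Z (suc (length σ)) (if b then 2 ^ length σ + val σ else val σ)
    child Z σ b = trans (value≡martingale Z (σ ++ b ∷ []))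
                        (cong₂ (martingale Z) (length-∷ʳ σ b) (val-∷ʳ-if σ b))

  0≤term : ∀ Z k ℓ v → 0ℚ ℚ.≤ term Z k ℓ v
  0≤term Z k ℓ v = 0≤* (0≤½^ (suc k))
    (0≤+ (0≤frac _ _) (0≤* (0≤frac (weight k) 0) (0≤* (0≤frac (extending Z k ℓ v) 0) (0≤½^ (F k ∸ ℓ)))))

  nonempty⇒n<F : ∀ {Y} n {v} → v < 2 ^ F n → bit v (G Y n) ≡ true → n < F n
  nonempty⇒n<F {Y} n v<2^F v∈G = ≤-<-trans (m≤n*m n 3) (<-trans (n<1+n (3 * n)) (2^-cancel-< (begin-strict
    2 ^ level n
      ≡⟨ *-identityˡ (2 ^ level n) ⟨
    1 * 2 ^ level n
      ≤⟨ *-monoˡ-≤ (2 ^ level n) (≤-trans (s≤s z≤n) (countBits<countBits v<2^F v∈G)) ⟩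
    countBits (2 ^ F n) (G Y n) * 2 ^ level n
      <⟨ measure-small Y (level n) ⟩
    2 ^ F n
      ∎)))
    where open ≤-Reasoning

  member⇒1≤density : ∀ {Y} n {v} → v < 2 ^ F n → bit v (G Y n) ≡ true → 1ℚ ℚ.≤ density Y n (F n) v
  member⇒1≤density {Y} n {v} v<2^F v∈G = begin
    1ℚ                   ≡⟨ frac-1-0 ⟨
    ι 1                  ≤⟨ ι-mono-≤ 1≤E ⟩
    ι E                  ≡⟨ ℚP.*-identityʳ (ι E) ⟨
    ι E ℚ.* 1ℚ           ≡⟨ cong (ι E ℚ.*_) ½^-zero ⟨
    ι E ℚ.* ½^ 0         ≡⟨ density-above Y n v ≤-refl ⟨
    density Y n (F n) v  ∎
    where
    open ℚP.≤-Reasoning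
    E : ℕ
    E = extensions Y n (F n) (v %2^ F n)
    1≤E : 1 ≤ E
    1≤E = ≤-trans (≤-reflexive (sym (cong₂ _*_ (cong indicator v∈G) (indicator-T (≡⇒≡ᵇ (v %2^ F n) _ refl)))))
                  (term≤∑< (λ p → indicator (bit p (G Y n)) * indicator (p %2^ F n ≡ᵇ v %2^ F n)) v<2^F)

  member⇒large : ∀ {Y X} n → bit (val (X ↾ F n)) (G Y n) ≡ true →
                 ι (2 ^ n) ℚ.≤ martingale Y (F n) (val (X ↾ F n))
  member⇒large {Y} {X} n v∈G = begin
    ι (2 ^ n)
      ≡⟨ ½^-weight n ⟨
    ½^ (suc n) ℚ.* ι (weight n)
      ≤⟨ ℚP.*-monoˡ-≤-nonNeg (½^ (suc n)) {{ℚ.nonNegative (0≤½^ (suc n))}} weight≤component ⟩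
    term Y n (F n) v
      ≤⟨ term≤∑ℚ< (F n) (λ k → term Y k (F n) v) (nonempty⇒n<F n v<2^F v∈G) (λ k → 0≤term Y k (F n) v) ⟩
    ∑ℚ< (F n) (λ k → term Y k (F n) v)
      ≤⟨ q≤p+q _ (0≤½^ (F n)) ⟩
    martingale Y (F n) v
      ∎
    where
    open ℚP.≤-Reasoning
    v : ℕ
    v = val (X ↾ F n)
    v<2^F : v < 2 ^ F n
    v<2^F = val-↾<2^ X (F n)
    weight≤component : ι (weight n) ℚ.≤ component Y n (F n) v
    weight≤component = begin
      ι (weight n)
        ≡⟨ ℚP.*-identityʳ (ι (weight n)) ⟨
      ι (weight n) ℚ.* 1ℚ
        ≤⟨ ℚP.*-monoˡ-≤-nonNeg (ι (weight n)) {{ℚ.nonNegative (0≤frac _ 0)}} (member⇒1≤density n v<2^F v∈G) ⟩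
      ι (weight n) ℚ.* density Y n (F n) v
        ≤⟨ q≤p+q _ (0≤frac _ _) ⟩
      component Y n (F n) v
        ∎

covered⇒succeeds : ∀ {X Y} → Covered X Y → MartingaleSucceeds X Y
covered⇒succeeds {X} {Y} (T , cover) = coverMartingale , F , F-pr , λ n →
  subst₂ ℚ._≤_ (frac-def (2 ^ n) 0) (sym (d≡martingale n)) (member⇒large n (cover (level n)))
  where
  open PRTest T
  open CoverMartingale T
  F-pr : PrimRec F
  F-pr = PrimRec-∘ f-pr (pr-suc (pr-* (pr-const 3) (pr-var 0F)))
  d≡martingale : ∀ n → value Y (code (X ↾ F n)) ≡ martingale Y (F n) (val (X ↾ F n))
  d≡martingale n = trans (value≡martingale Y (X ↾ F n))
                         (cong (λ ℓ → martingale Y ℓ (val (X ↾ F n))) (length-↾ X (F n)))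

theorem2p14 : ∀ (X Y : Real) →
    (KolmogorovBPRandom X Y ⇔ MartinLofBPRandom X Y) ×
    (MartinLofBPRandom X Y ⇔ MartingaleBPRandom X Y)
theorem2p14 X Y =
  mk⇔ (λ incompressible T covers → incompressible (covered⇒compressible (T , covers)))
      (λ ml-random compressible → uncurry ml-random (compressible⇒covered compressible)) ,
  mk⇔ (λ ml-random D succeeds → uncurry ml-random (succeeds⇒covered (D , succeeds)))
      (λ martingale-random T covers → uncurry martingale-random (covered⇒succeeds (T , covers)))
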